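{- Let $e$ be a planar circular electrical network with $n$ boundary vertices, with grove measurements $L_\sigma$, and let $\Delta_I=\sum_{\sigma\text{ concordant with }I}L_\sigma$ for $(n-1)$-subsets $I\subset\{1,\dots,2n\}$. Then: (1) $L=\Delta_R$ for every subset $R$ of the even indices $\{2,4,\dots,2n\}$ with $|R|=n-1$; (2) for $i\neq j$, $L_{ij}=\Delta_{\{2i-1\}\cup N}$, where $N$ is the set of all even indices except the two even indices closest to $2j-1$ (namely $2j-2$ and $2j$, with $0$ read as $2n$), so $|N|=n-2$; (3) for each $k$, $L_{kk}=\Delta_{\{2k-1\}\cup T}$, where $T$ is the set of all even indices except $2k-2$ and $2k$ (with $0$ read as $2n$).
   Context: An electrical network is a graph embedded in a disk with boundary vertices $\bar1,\dots,\bar n$ in circular order on the boundary circle and positive edge conductances. A grove is a spanning forest in which every component contains a boundary vertex. Its boundary partition is the non-crossing partition of $\{\bar1,\dots,\bar n\}$ induced by the components. For a non-crossing partition $\sigma$, $L_\sigma$ is the sum over groves with boundary partition $\sigma$ of the product of their edge conductances. Notation: - $L$ denotes $L_\sigma$ for the partition into singletons. - $L_{ij}$ (for $i\ne j$) denotes $L_\sigma$ for the partition with block $\{\bar i,\bar j\}$ and all other blocks singletons. - $L_{kk}=\sum_{i\neq k}L_{ik}$. Dual partition: points $\tilde i$ lie between $\bar i$ and $\overline{i+1}$. The dual $\tilde\sigma$ is the Kreweras complement, i.e. the coarsest non-crossing partition of the $\tilde i$'s such that $\sigma\cup\tilde\sigma$ is non-crossing. Identify $\bar i\leftrightarrow 2i-1$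 and $\tilde i\leftrightarrow 2i$. An $(n-1)$-subset $I\subset\{1,\dots,2n\}$ is concordant with $\sigma$ if each block of $\sigma$ and each block of $\tilde\sigma$ contains exactly one element not in $I$. The numbers $\Delta_I$ are the Plücker coordinates of Lam's embedding of the network into $\mathrm{Gr}(n-1,2n)$. They equal the almost-perfect-matching boundary measurements $\Delta_I^M$ of the associated bipartite network.
   Formalization: The edge conductances of each network take values in the positive rationals. -}

module Defs where

open import Data.Bool.Base using (Bool; true; false; _∧_; _∨_; not; if_then_else_)
open import Data.Nat.Base using (ℕ; zero; suc; _+_; _*_; _∸_; _≡ᵇ_; _≤ᵇ_; _<ᵇ_)
open import Data.Nat.DivMod using (_%_; _/_; m%n<n)
open import Data.Fin.Base using (Fin; toℕ; fromℕ<; splitAt; join)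
open import Data.Fin.Subset using (Subset)
open import Data.List.Base using (List; []; _∷_; map; concatMap; allFin; upTo; foldr)
open import Data.Bool.ListAction using (any; all)
open import Data.Product.Base using (_×_; _,_; proj₁; proj₂; ∃)
open import Data.Sum.Base using (inj₁; inj₂)
open import Data.Vec.Base using (Vec; lookup; tabulate)
  renaming ([] to []ᵥ; _∷_ to _∷ᵥ_)
open import Data.Rational.Base using (ℚ; 0ℚ) renaming (_+_ to _+ℚ_; _*_ to _*ℚ_)
open import Relation.Binary.PropositionalEquality using (_≡_)

eqF : ∀ {k} → Fin k → Fin k → Bool
eqF i j = toℕ i ≡ᵇ toℕ j

beq : Bool → Bool → Bool
beq true  b = b
beq false b = not b

countB : ∀ {A : Set} → (A → Bool) → List A → ℕ
countB p []       = 0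
countB p (x ∷ xs) = if p x then suc (countB p xs) else countB p xs

sumℚ : List ℚ → ℚ
sumℚ = foldr _+ℚ_ 0ℚ

iter : ∀ {A : Set} → ℕ → (A → A) → A → A
iter zero    f x = x
iter (suc k) f x = f (iter k f x)

allSubsets : (k : ℕ) → List (Vec Bool k)
allSubsets zero    = []ᵥ ∷ []
allSubsets (suc k) = concatMap (λ s → (true ∷ᵥ s) ∷ (false ∷ᵥ s) ∷ []) (allSubsets k)

nextF : ∀ {n} → Fin n → Fin n
nextF {suc k} i = fromℕ< (m%n<n (suc (toℕ i)) (suc k))

prevF : ∀ {n} → Fin n → Fin n
prevF {suc k} i = fromℕ< (m%n<n (toℕ i + k) (suc k))

-- Set partitions of {0,…,n-1}, enumerated without repetition as
-- restricted growth strings (block labels), and non-crossing partitions.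

rgsFrom : ℕ → ℕ → List (List ℕ)
rgsFrom zero    used = [] ∷ []
rgsFrom (suc k) used =
  concatMap (λ c → map (c ∷_) (rgsFrom k (if c ≡ᵇ used then suc used else used)))
            (upTo (suc used))

-- every set partition of {0,…,n-1} occurs exactly once
allPartitions : ℕ → List (List ℕ)
allPartitions n = rgsFrom n 0

labelAt : List ℕ → ℕ → ℕ
labelAt []       _       = 0
labelAt (x ∷ xs) zero    = x
labelAt (x ∷ xs) (suc a) = labelAt xs a

sameL : List ℕ → ℕ → ℕ → Bool
sameL s a b = labelAt s a ≡ᵇ labelAt s b

relOf : ∀ {n} → List ℕ → Fin n → Fin n → Bool
relOf s i j = sameL s (toℕ i) (toℕ j)

nonCrossing : ℕ → (ℕ → ℕ → Bool) → Bool
nonCrossing k R =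
  all (λ a → all (λ b → all (λ c → all (λ d →
    not ((a <ᵇ b) ∧ (b <ᵇ c) ∧ (c <ᵇ d) ∧ R a c ∧ R b d ∧ not (R a b)))
    (upTo k)) (upTo k)) (upTo k)) (upTo k)

even? : ℕ → Bool
even? p = p % 2 ≡ᵇ 0

-- The 2n points 1,…,2n of the paper are 0,…,2n-1 here (paper index = ours + 1).
-- Paper point 2i-1 = \bar i ; paper point 2i = \tilde i.  With 0-based vertex
-- index i (paper i+1): \bar i is our point 2i, \tilde i is our point 2i+1.
-- Union partition σ ∪ τ (σ on the \bar's, τ on the \tilde's):
unionRel : List ℕ → List ℕ → ℕ → ℕ → Bool
unionRel s t p q =
  if even? p ∧ even? q then sameL s (p / 2) (q / 2)
  else if not (even? p) ∧ not (even? q) then sameL t (p / 2) (q / 2)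
  else false

refines : ℕ → List ℕ → List ℕ → Bool
refines n t' t = all (λ a → all (λ b → not (sameL t' a b) ∨ sameL t a b) (upTo n)) (upTo n)

isKreweras : ℕ → List ℕ → List ℕ → Bool
isKreweras n s t =
  nonCrossing (2 * n) (unionRel s t) ∧
  all (λ t' → not (nonCrossing (2 * n) (unionRel s t')) ∨ refines n t' t) (allPartitions n)

memI : ∀ {n} → Subset (2 * n) → ℕ → Bool
memI {n} I p = any (λ q → (toℕ q ≡ᵇ p) ∧ lookup I q) (allFin (2 * n))

blocksOK : ∀ {n} → Subset (2 * n) → (ℕ → ℕ) → List ℕ → Bool
blocksOK {n} I pt s =
  all (λ a → countB (λ b → sameL s a b ∧ not (memI {n} I (pt b))) (upTo n) ≡ᵇ 1) (upTo n)

concordant : ∀ {n} → Subset (2 * n) → List ℕ → Bool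
concordant {n} I s =
  any (λ t → isKreweras n s t ∧ blocksOK {n} I (λ b → 2 * b) s
                                ∧ blocksOK {n} I (λ b → suc (2 * b)) t)
      (allPartitions n)

-- A graph with vertices Fin m, edges Fin E (multi-edges / loops allowed),
-- positive conductances, and boundary vertices bd 0, …, bd (n-1)
-- (= \bar 1, …, \bar n of the paper).
record Network (n : ℕ) : Set where
  field
    m E  : ℕ
    src  : Fin E → Fin m
    tgt  : Fin E → Fin m
    cond : Fin E → ℚ
    bd   : Fin n → Fin m

module _ {n : ℕ} (N : Network n) where
  open Network N

  -- Embedding in a disk with the boundary vertices on the circle in
  -- circular order, encoded combinatorially: add a vertex ∞ (outside the
  -- disk) joined by a new edge to each boundary vertex; the augmented graph
  -- carries a rotation system of genus 0 whose rotation at ∞ is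
  -- bd 0, bd 1, …, bd (n-1) in cyclic order.

  augEnds : Fin (E + n) → Fin (suc m) × Fin (suc m)
  augEnds e with splitAt E e
  ... | inj₁ e₀ = Fin.suc (src e₀) , Fin.suc (tgt e₀)
    where import Data.Fin.Base as Fin
  ... | inj₂ i  = Fin.suc (bd i) , Fin.zero
    where import Data.Fin.Base as Fin

  Dart : Set
  Dart = Fin (E + n) × Bool

  tailD : Dart → Fin (suc m)
  tailD (e , false) = proj₁ (augEnds e)
  tailD (e , true)  = proj₂ (augEnds e)

  αD : Dart → Dart
  αD (e , b) = e , not b

  darts : List Dart
  darts = concatMap (λ e → (e , false) ∷ (e , true) ∷ []) (allFin (E + n))

  #darts : ℕ
  #darts = 2 * (E + n)

  key : Dart → ℕ
  key (e , b) = 2 * toℕ e + (if b then 1 else 0)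

  eqD : Dart → Dart → Bool
  eqD d d' = key d ≡ᵇ key d'

  cycles : (Dart → Dart) → ℕ
  cycles p = countB (λ d → all (λ j → key d ≤ᵇ key (iter j p d)) (upTo #darts)) darts

  reachD : (Dart → Dart) → ℕ → Dart → Dart → Bool
  reachD p zero    d d' = eqD d d'
  reachD p (suc t) d d' =
    reachD p t d d' ∨ any (λ x → reachD p t d x ∧ (eqD (p x) d' ∨ eqD (αD x) d')) darts

  mapComponents : (Dart → Dart) → ℕ
  mapComponents p =
    countB (λ d → all (λ x → not (reachD p #darts d x) ∨ (key d ≤ᵇ key x)) darts) darts

  record CircularPlanarEmbedding : Set where
    field
      rot      : Dart → Dart
      rot⁻¹    : Dart → Dart
      rot-inv₁ : ∀ d → rot⁻¹ (rot d) ≡ d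
      rot-inv₂ : ∀ d → rot (rot⁻¹ d) ≡ d
      rot-tail : ∀ d → tailD (rot d) ≡ tailD d
      rot-cyc  : ∀ d d' → tailD d ≡ tailD d' → ∃ λ k → iter k rot d ≡ d'
      -- rotation at ∞ lists the boundary vertices in circular order
      rot-∞    : ∀ i → rot (join E n (inj₂ i) , true) ≡ (join E n (inj₂ (nextF i)) , true)
      -- genus 0 (Euler): #vertex-cycles - #edges + #faces = 2 #components
      genus0   : cycles rot + cycles (λ d → rot (αD d)) ≡ (E + n) + 2 * mapComponents rot

  reach : Vec Bool E → ℕ → Fin m → Fin m → Bool
  reach S zero    u v = eqF u v
  reach S (suc t) u v =
    reach S t u v ∨
    any (λ e → lookup S e ∧ ((reach S t u (src e) ∧ eqF (tgt e) v)
                             ∨ (reach S t u (tgt e) ∧ eqF (src e) v))) (allFin E)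

  conn : Vec Bool E → Fin m → Fin m → Bool
  conn S = reach S m

  without : Vec Bool E → Fin E → Vec Bool E
  without S e = tabulate (λ e' → lookup S e' ∧ not (eqF e e'))

  -- acyclic: every edge of S is a bridge of S (a loop never is)
  isForest : Vec Bool E → Bool
  isForest S = all (λ e → not (lookup S e) ∨ not (conn (without S e) (src e) (tgt e))) (allFin E)

  bdInEveryComponent : Vec Bool E → Bool
  bdInEveryComponent S = all (λ v → any (λ i → conn S v (bd i)) (allFin n)) (allFin m)

  isGrove : Vec Bool E → Bool
  isGrove S = isForest S ∧ bdInEveryComponent S

  hasPartition : Vec Bool E → (Fin n → Fin n → Bool) → Bool
  hasPartition S R = all (λ i → all (λ j → beq (conn S (bd i) (bd j)) (R i j)) (allFin n)) (allFin n)

  weight : Vec Bool E → ℚ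
  weight S = foldr (λ e acc → if lookup S e then cond e *ℚ acc else acc) (Data.Rational.Base.1ℚ) (allFin E)
    where import Data.Rational.Base

  Lσ : (Fin n → Fin n → Bool) → ℚ
  Lσ R = sumℚ (map (λ S → if isGrove S ∧ hasPartition S R then weight S else 0ℚ) (allSubsets E))

  L : ℚ
  L = Lσ eqF

  Lij : Fin n → Fin n → ℚ
  Lij i j = Lσ (λ a b → eqF a b ∨ (eqF a i ∧ eqF b j) ∨ (eqF a j ∧ eqF b i))

  Lkk : Fin n → ℚ
  Lkk k = sumℚ (map (λ i → if eqF i k then 0ℚ else Lij i k) (allFin n))

  Δ : Subset (2 * n) → ℚ
  Δ I = sumℚ (map (λ s → if nonCrossing n (sameL s) ∧ concordant {n} I s
                          then Lσ (relOf s) else 0ℚ)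
                  (allPartitions n))

-- Index sets (our point q = paper index q+1)

evenIdx : (n : ℕ) → Subset (2 * n)
evenIdx n = tabulate (λ q → not (even? (toℕ q)))

barWithEvensExcept : ∀ {n} → Fin n → Fin n → Subset (2 * n)
barWithEvensExcept {n} i j =
  tabulate (λ q → (toℕ q ≡ᵇ 2 * toℕ i)
                  ∨ (not (even? (toℕ q)) ∧ not (toℕ q / 2 ≡ᵇ toℕ j)
                                         ∧ not (toℕ q / 2 ≡ᵇ toℕ (prevF j))))

-- Δ_I sums L_σ over the non-crossing σ concordant with I, and every partition
-- occurs exactly once in allPartitions, so it suffices to find those σ.
-- Concordance on the bars forces the blocks of σ: when no bar lies in I, each
-- block is a singleton; when only bar i lies in I, σ pairs i with one other bar x
-- and is otherwise discrete.  The Kreweras complement of the discrete partition is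
-- the one-block partition, and that of the pair {lo, hi} splits the tildes into
-- those between bar lo and bar hi and the rest.  Concordance on the tildes then
-- asks for exactly one tilde outside I in each block: for an (n-1)-set of tildes
-- R this always holds, giving Δ_R = L; for the index set of (2) and (3), whose
-- missing tildes are the two next to bar j, it holds iff j ∈ {i, x}.  Thus only
-- the pair {i, j} contributes when i ≢ j, and every pair {k, x} when i = j = k.

module Submission where

open import Defs
open import Data.Nat.Base using (ℕ; _∸_; _*_)
open import Data.Fin.Base using (Fin)
open import Data.Fin.Subset using (Subset; ∣_∣; _⊆_)
open import Data.Product.Base using (_×_)
open import Data.Rational.Base using (Positive)
open import Relation.Binary.PropositionalEquality using (_≡_; _≢_)
open import Function.Definitions using (Injective)

open import Algebra.Bundles using (CommutativeMonoid)
open import Data.Bool.Base using (Bool; true; false; T; _∧_; _∨_; not; if_then_else_)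
open import Data.Bool.Properties using (T-∧; T-∨; T-≡; T-not-≡; ∨-identityʳ; not-involutive; ¬-not)
  renaming (_≟_ to _≟ᵇ_)
open import Data.Bool.ListAction using (all; any; and)
open import Data.Empty using (⊥; ⊥-elim)
open import Data.Fin.Base as Fin using (toℕ; fromℕ<)
open import Data.Fin.Properties using (toℕ<n; toℕ-fromℕ<; toℕ-injective)
open import Data.List.Base using (List; []; _∷_; [_]; _∷ʳ_; _++_; length; map; concatMap; applyUpTo; upTo; allFin)
open import Data.List.Membership.Propositional using (_∈_; find; lose)
open import Data.List.Membership.Propositional.Properties using (∈-upTo⁺; ∈-upTo⁻; ∈-allFin)
open import Data.List.Properties
  using (map-cong; length-++; ++-identityʳ; ∷ʳ-++; map-applyUpTo; upTo-∷ʳ; length-upTo)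
open import Data.List.Relation.Unary.All as All using ()
open import Data.List.Relation.Unary.All.Properties using (all⁺; all⁻)
open import Data.List.Relation.Unary.AllPairs using ([]; _∷_)
open import Data.List.Relation.Unary.Any using (here; there; any?)
open import Data.List.Relation.Unary.Any.Properties using (any⁺; any⁻)
open import Data.List.Relation.Unary.Unique.Propositional using (Unique)
open import Data.List.Relation.Unary.Unique.Propositional.Properties using (upTo⁺; allFin⁺)
open import Data.Nat.Base
  using (zero; suc; pred; _+_; _≤_; _<_; _≡ᵇ_; _<ᵇ_; _≤ᵇ_; z≤n; s≤s; z<s; s<s; s<s⁻¹)
open import Data.Nat.DivMod
  using (_%_; _/_; m*n%n≡0; [m+kn]%n≡m%n; [m+n]%n≡m%n; m*n/n≡m; m%n<n; m<n⇒m%n≡m; +-distrib-/-∣ʳ)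
open import Data.Nat.Divisibility using (divides)
open import Data.Nat.Properties
open import Data.Product.Base using (_,_; proj₁; proj₂; ∃)
open import Data.Rational.Base using (ℚ; 0ℚ) renaming (_+_ to _+ℚ_)
open import Data.Rational.Properties using ()
  renaming ( +-0-commutativeMonoid to +ℚ-0-commutativeMonoid
           ; +-identityˡ to +ℚ-identityˡ; +-identityʳ to +ℚ-identityʳ)
open import Data.Sum.Base using (_⊎_; inj₁; inj₂; swap)
open import Data.Unit.Base using (tt)
open import Data.Vec.Base using (Vec; lookup; tabulate) renaming ([] to []ᵥ; _∷_ to _∷ᵥ_)
open import Data.Vec.Properties using (lookup∘tabulate; []=⇒lookup; lookup⇒[]=)
open import Function.Base using (_∘_; id; const)
open import Function.Bundles using (Equivalence)
open import Relation.Binary.Definitions using (tri<; tri≈; tri>)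
open import Relation.Binary.PropositionalEquality using (refl; sym; trans; cong; cong₂; subst; module ≡-Reasoning)
open import Relation.Nullary using (¬_; Dec; yes; no)
open import Relation.Nullary.Decidable using (T?)

open import Algebra.Properties.CommutativeSemigroup +-commutativeSemigroup
  using () renaming (interchange to +-interchange)
open import Algebra.Properties.CommutativeSemigroup (CommutativeMonoid.commutativeSemigroup +ℚ-0-commutativeMonoid)
  using () renaming (interchange to +ℚ-interchange)
open Equivalence using (to; from)

T-injective : ∀ {x y} → (T x → T y) → (T y → T x) → x ≡ y
T-injective {false} {false} _ _ = refl
T-injective {false} {true}  _ g = ⊥-elim (g tt)
T-injective {true}  {false} f _ = ⊥-elim (f tt)
T-injective {true}  {true}  _ _ = refl

T-not⁺ : ∀ {x} → ¬ T x → T (not x)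
T-not⁺ {false} _ = tt
T-not⁺ {true}  ¬x = ¬x tt

T-not⁻ : ∀ {x} → T (not x) → ¬ T x
T-not⁻ {false} _ ()

T-implication⁺ : ∀ {x y} → (T x → T y) → T (not x ∨ y)
T-implication⁺ {false} _ = tt
T-implication⁺ {true}  f = f tt

T-implication⁻ : ∀ {x y} → T (not x ∨ y) → T x → T y
T-implication⁻ {true} y _ = y

T-beq⁺ : ∀ {x y} → x ≡ y → T (beq x y)
T-beq⁺ {false} refl = tt
T-beq⁺ {true}  refl = tt

T-beq⁻ : ∀ {x y} → T (beq x y) → x ≡ y
T-beq⁻ {false} {false} _ = refl
T-beq⁻ {true}  {true}  _ = refl

≢⇒T-not-≡ᵇ : ∀ {m n} → m ≢ n → T (not (m ≡ᵇ n))
≢⇒T-not-≡ᵇ {m} {n} m≢n = T-not⁺ (m≢n ∘ ≡ᵇ⇒≡ m n)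

all-upTo⁻ : ∀ (p : ℕ → Bool) {k} → T (all p (upTo k)) → ∀ {a} → a < k → T (p a)
all-upTo⁻ p ok a<k = All.lookup (all⁺ p _ ok) (∈-upTo⁺ a<k)

all-upTo⁺ : ∀ (p : ℕ → Bool) {k} → (∀ {a} → a < k → T (p a)) → T (all p (upTo k))
all-upTo⁺ p h = all⁻ p (All.tabulate (h ∘ ∈-upTo⁻))

module _ {A : Set} (p : A → Bool) where

  countB-≡0 : ∀ {xs} → (∀ {x} → x ∈ xs → ¬ T (p x)) → countB p xs ≡ 0
  countB-≡0 {[]}     _ = refl
  countB-≡0 {x ∷ xs} h with p x in px
  ... | true  = ⊥-elim (h (here refl) (subst T (sym px) tt))
  ... | false = countB-≡0 (h ∘ there)

  countB-≡0⁻ : ∀ {xs x} → countB p xs ≡ 0 → x ∈ xs → ¬ T (p x)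
  countB-≡0⁻ {y ∷ xs} c x∈ px with p y in py
  countB-≡0⁻ {y ∷ xs} () x∈ px | true
  countB-≡0⁻ {y ∷ xs} c (here refl) px | false = subst T py px
  countB-≡0⁻ {y ∷ xs} c (there x∈) px | false = countB-≡0⁻ c x∈ px

  countB-≡1 : ∀ {xs x} → Unique xs → x ∈ xs → T (p x) →
              (∀ {y} → y ∈ xs → T (p y) → y ≡ x) → countB p xs ≡ 1
  countB-≡1 {y ∷ xs} (y∉xs ∷ _) (here refl) px only with p y
  ... | true  = cong suc (countB-≡0 λ z∈ pz → All.lookup y∉xs z∈ (sym (only (there z∈) pz)))
  ... | false = ⊥-elim px
  countB-≡1 {y ∷ xs} (y∉xs ∷ uniq) (there x∈) px only with p y in py
  ... | true  = ⊥-elim (All.lookup y∉xs x∈ (only (here refl) (subst T (sym py) tt)))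
  ... | false = countB-≡1 uniq x∈ px (only ∘ there)

  countB-≡1-unique : ∀ {xs x y} → countB p xs ≡ 1 → x ∈ xs → y ∈ xs → T (p x) → T (p y) → x ≡ y
  countB-≡1-unique {z ∷ xs} c x∈ y∈ px py with p z in pz
  countB-≡1-unique {z ∷ xs} c (here refl) (here refl) px py | true = refl
  countB-≡1-unique {z ∷ xs} c (here refl) (there y∈) px py | true =
    ⊥-elim (countB-≡0⁻ (suc-injective c) y∈ py)
  countB-≡1-unique {z ∷ xs} c (there x∈) _ px py | true = ⊥-elim (countB-≡0⁻ (suc-injective c) x∈ px)
  countB-≡1-unique {z ∷ xs} c (here refl) _ px py | false = ⊥-elim (subst T pz px)
  countB-≡1-unique {z ∷ xs} c (there x∈) (here refl) px py | false = ⊥-elim (subst T pz py)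
  countB-≡1-unique {z ∷ xs} c (there x∈) (there y∈) px py | false = countB-≡1-unique c x∈ y∈ px py

  countB-≡1-witness : ∀ {xs} → countB p xs ≡ 1 → ∃ λ x → x ∈ xs × T (p x)
  countB-≡1-witness {y ∷ xs} c with p y in py
  ... | true  = y , here refl , subst T (sym py) tt
  ... | false = let x , x∈ , px = countB-≡1-witness c in x , there x∈ , px

  countB-cong : ∀ {q : A → Bool} {xs} → (∀ {x} → x ∈ xs → p x ≡ q x) → countB p xs ≡ countB q xs
  countB-cong {xs = []}     _  = refl
  countB-cong {xs = x ∷ xs} eq rewrite eq (here refl) =
    cong (λ c → if _ then suc c else c) (countB-cong (eq ∘ there))

  countB-++ : ∀ xs ys → countB p (xs ++ ys) ≡ countB p xs + countB p ys
  countB-++ []       ys = refl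
  countB-++ (x ∷ xs) ys with p x
  ... | true  = cong suc (countB-++ xs ys)
  ... | false = countB-++ xs ys

  countB-+-countB-not : ∀ xs → countB p xs + countB (not ∘ p) xs ≡ length xs
  countB-+-countB-not []       = refl
  countB-+-countB-not (x ∷ xs) with p x
  ... | true  = cong suc (countB-+-countB-not xs)
  ... | false = trans (+-suc _ _) (cong suc (countB-+-countB-not xs))

  countB-concatMap-≡0 : ∀ {B : Set} {g : B → List A} xs → (∀ {x} → x ∈ xs → countB p (g x) ≡ 0) →
                        countB p (concatMap g xs) ≡ 0
  countB-concatMap-≡0         []       _ = refl
  countB-concatMap-≡0 {g = g} (x ∷ xs) h =
    trans (countB-++ (g x) _) (cong₂ _+_ (h (here refl)) (countB-concatMap-≡0 xs (h ∘ there)))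

  countB-concatMap-≡1 : ∀ {B : Set} {g : B → List A} {xs c} → Unique xs → c ∈ xs →
    countB p (g c) ≡ 1 → (∀ {x} → x ∈ xs → x ≢ c → countB p (g x) ≡ 0) →
    countB p (concatMap g xs) ≡ 1
  countB-concatMap-≡1 {g = g} {y ∷ xs} (y∉xs ∷ _) (here refl) one others =
    trans (countB-++ (g y) _)
      (cong₂ _+_ one (countB-concatMap-≡0 xs (λ x∈ → others (there x∈) (All.lookup y∉xs x∈ ∘ sym))))
  countB-concatMap-≡1 {g = g} {y ∷ xs} (y∉xs ∷ uniq) (there c∈) one others =
    trans (countB-++ (g y) _)
      (cong₂ _+_ (others (here refl) (λ y≡c → All.lookup y∉xs c∈ y≡c))
                 (countB-concatMap-≡1 uniq c∈ one (others ∘ there)))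

countB-map : ∀ {A B : Set} (p : B → Bool) (f : A → B) xs → countB p (map f xs) ≡ countB (p ∘ f) xs
countB-map p f []       = refl
countB-map p f (x ∷ xs) with p (f x)
... | true  = cong suc (countB-map p f xs)
... | false = countB-map p f xs

countB-upTo-double : ∀ (p : ℕ → Bool) n →
  countB p (upTo (2 * n)) ≡ countB (p ∘ (2 *_)) (upTo n) + countB (λ b → p (suc (2 * b))) (upTo n)
countB-upTo-double p zero    = refl
countB-upTo-double p (suc n) = begin
  countB p (upTo (2 * suc n))                                     ≡⟨ cong (countB p ∘ upTo) (*-suc 2 n) ⟩
  countB p (upTo (suc (suc (2 * n))))                             ≡⟨ cong (countB p) (sym (upTo-+2 (2 * n))) ⟩
  countB p (upTo (2 * n) ++ 2 * n ∷ suc (2 * n) ∷ [])             ≡⟨ countB-++ p (upTo (2 * n)) _ ⟩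
  countB p (upTo (2 * n)) + countB p (2 * n ∷ suc (2 * n) ∷ [])   ≡⟨ cong₂ _+_ (countB-upTo-double p n)
                                                                       (countB-++ p [ 2 * n ] [ suc (2 * n) ]) ⟩
  (countB bar? (upTo n) + countB tilde? (upTo n)) + (countB bar? [ n ] + countB tilde? [ n ])
                                                                  ≡⟨ +-interchange (countB bar? (upTo n)) (countB tilde? (upTo n))
                                                                                   (countB bar? [ n ]) (countB tilde? [ n ]) ⟩
  (countB bar? (upTo n) + countB bar? [ n ]) + (countB tilde? (upTo n) + countB tilde? [ n ])
                                                                  ≡⟨ sym (cong₂ _+_ (snoc bar?) (snoc tilde?)) ⟩
  countB bar? (upTo (suc n)) + countB tilde? (upTo (suc n))       ∎
  where
  open ≡-Reasoning
  bar? tilde? : ℕ → Bool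
  bar?   b = p (2 * b)
  tilde? b = p (suc (2 * b))
  upTo-+2 : ∀ m → upTo m ++ m ∷ suc m ∷ [] ≡ upTo (suc (suc m))
  upTo-+2 m = trans (sym (∷ʳ-++ (upTo m) m [ suc m ])) (trans (cong (_∷ʳ suc m) (upTo-∷ʳ m)) (upTo-∷ʳ (suc m)))
  snoc : ∀ q → countB q (upTo (suc n)) ≡ countB q (upTo n) + countB q [ n ]
  snoc q = trans (cong (countB q) (sym (upTo-∷ʳ n))) (countB-++ q (upTo n) [ n ])

sumIf : ∀ {A : Set} → (A → Bool) → (A → ℚ) → List A → ℚ
sumIf P F xs = sumℚ (map (λ x → if P x then F x else 0ℚ) xs)

module _ {A : Set} (P : A → Bool) (F : A → ℚ) where

  sumIf-≡0 : ∀ xs → countB P xs ≡ 0 → sumIf P F xs ≡ 0ℚ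
  sumIf-≡0 []       _ = refl
  sumIf-≡0 (x ∷ xs) c with P x
  ... | false = trans (+ℚ-identityˡ _) (sumIf-≡0 xs c)

  sumIf-≡1 : ∀ xs {c} → countB P xs ≡ 1 → (∀ {x} → x ∈ xs → T (P x) → F x ≡ c) → sumIf P F xs ≡ c
  sumIf-≡1 (x ∷ xs) one val with P x in px
  ... | true  = trans (cong₂ _+ℚ_ (val (here refl) (subst T (sym px) tt)) (sumIf-≡0 xs (suc-injective one)))
                      (+ℚ-identityʳ _)
  ... | false = trans (+ℚ-identityˡ _) (sumIf-≡1 xs one (val ∘ there))

sumℚ-zeros : ∀ {A : Set} (xs : List A) → sumℚ (map (const 0ℚ) xs) ≡ 0ℚ
sumℚ-zeros []       = refl
sumℚ-zeros (x ∷ xs) = trans (+ℚ-identityˡ _) (sumℚ-zeros xs)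

sumℚ-+ : ∀ {A : Set} (f g : A → ℚ) xs →
         sumℚ (map f xs) +ℚ sumℚ (map g xs) ≡ sumℚ (map (λ x → f x +ℚ g x) xs)
sumℚ-+ f g []       = +ℚ-identityˡ 0ℚ
sumℚ-+ f g (x ∷ xs) = trans (+ℚ-interchange (f x) _ (g x) _) (cong (f x +ℚ g x +ℚ_) (sumℚ-+ f g xs))

sumℚ-swap : ∀ {A B : Set} (h : B → A → ℚ) xs is →
  sumℚ (map (λ x → sumℚ (map (λ i → h i x) is)) xs) ≡ sumℚ (map (λ i → sumℚ (map (h i) xs)) is)
sumℚ-swap h []       is = sym (sumℚ-zeros is)
sumℚ-swap h (x ∷ xs) is =
  trans (cong (sumℚ (map (λ i → h i x) is) +ℚ_) (sumℚ-swap h xs is))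
        (sumℚ-+ (λ i → h i x) (λ i → sumℚ (map (h i) xs)) is)

sumIf-split : ∀ {A B : Set} (P : A → Bool) (Q : B → A → Bool) (F : A → ℚ) xs {is} → Unique is →
  (∀ x → T (P x) → ∃ λ i → i ∈ is × T (Q i x)) →
  (∀ {x i j} → T (Q i x) → T (Q j x) → i ≡ j) →
  (∀ {x i} → T (Q i x) → T (P x)) →
  sumIf P F xs ≡ sumℚ (map (λ i → sumIf (Q i) F xs) is)
sumIf-split P Q F xs {is} uniq some atMostOne sub =
  trans (cong sumℚ (map-cong split xs)) (sumℚ-swap (λ i x → if Q i x then F x else 0ℚ) xs is)
  where
  split : ∀ x → (if P x then F x else 0ℚ) ≡ sumIf (λ i → Q i x) (const (F x)) is
  split x with P x in px
  ... | true  = let i , i∈ , qi = some x (subst T (sym px) tt) in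
                sym (sumIf-≡1 (λ i → Q i x) (const (F x)) is
                       (countB-≡1 (λ i → Q i x) uniq i∈ qi (λ _ qj → atMostOne qj qi)) (λ _ _ → refl))
  ... | false = sym (sumIf-≡0 (λ i → Q i x) (const (F x)) is
                       (countB-≡0 (λ i → Q i x) {is} (λ _ qi → subst T px (sub qi))))

BoolRel : Set
BoolRel = ℕ → ℕ → Bool

record IsEquivOn (n : ℕ) (E : BoolRel) : Set where
  field
    reflexive  : ∀ {a} → a < n → T (E a a)
    symmetric  : ∀ {a b} → a < n → b < n → T (E a b) → T (E b a)
    transitive : ∀ {a b c} → a < n → b < n → c < n → T (E a b) → T (E b c) → T (E a c)

  symmetric-≡ : ∀ {a b} → a < n → b < n → E a b ≡ E b a
  symmetric-≡ a<n b<n = T-injective (symmetric a<n b<n) (symmetric b<n a<n)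

IsEquivOn-mono : ∀ {m n E} → m ≤ n → IsEquivOn n E → IsEquivOn m E
IsEquivOn-mono m≤n equiv = record
  { reflexive  = λ a<m → reflexive (lift a<m)
  ; symmetric  = λ a<m b<m → symmetric (lift a<m) (lift b<m)
  ; transitive = λ a<m b<m c<m → transitive (lift a<m) (lift b<m) (lift c<m) }
  where
  open IsEquivOn equiv
  lift : ∀ {a} → _ → a < _
  lift a<m = <-≤-trans a<m m≤n

record Represents (n : ℕ) (E : BoolRel) (s : List ℕ) : Set where
  constructor represents
  field sameL≡ : ∀ {a b} → a < n → b < n → sameL s a b ≡ E a b
open Represents

representsᵇ : ℕ → BoolRel → List ℕ → Bool
representsᵇ n E s = all (λ a → all (λ b → beq (sameL s a b) (E a b)) (upTo n)) (upTo n)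

module _ {n : ℕ} {E : BoolRel} {s : List ℕ} where

  representsᵇ⁻ : T (representsᵇ n E s) → Represents n E s
  representsᵇ⁻ ok = represents λ a<n b<n → T-beq⁻ (all-upTo⁻ _ (all-upTo⁻ _ ok a<n) b<n)

  representsᵇ⁺ : Represents n E s → T (representsᵇ n E s)
  representsᵇ⁺ rep = all-upTo⁺ _ λ a<n → all-upTo⁺ _ λ b<n → T-beq⁺ (sameL≡ rep a<n b<n)

  Represents-mono : ∀ {m} → m ≤ n → Represents n E s → Represents m E s
  Represents-mono m≤n rep = represents λ a<m b<m → sameL≡ rep (<-≤-trans a<m m≤n) (<-≤-trans b<m m≤n)

≡ᵇ-sym : ∀ m n → (m ≡ᵇ n) ≡ (n ≡ᵇ m)
≡ᵇ-sym m n = T-injective (λ e → ≡⇒≡ᵇ n m (sym (≡ᵇ⇒≡ m n e)))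
                         (λ e → ≡⇒≡ᵇ m n (sym (≡ᵇ⇒≡ n m e)))

module _ (s : List ℕ) where

  sameL-refl : ∀ a → T (sameL s a a)
  sameL-refl a = ≡⇒≡ᵇ (labelAt s a) _ refl

  sameL-sym : ∀ a b → sameL s a b ≡ sameL s b a
  sameL-sym a b = ≡ᵇ-sym (labelAt s a) (labelAt s b)


labelAt-++ˡ : ∀ p {s a} → a < length p → labelAt (p ++ s) a ≡ labelAt p a
labelAt-++ˡ (x ∷ p) {a = zero}  _         = refl
labelAt-++ˡ (x ∷ p) {a = suc a} (s≤s a<p) = labelAt-++ˡ p a<p

labelAt-length : ∀ p {c s} → labelAt (p ++ c ∷ s) (length p) ≡ c
labelAt-length []      = refl
labelAt-length (x ∷ p) = labelAt-length p

length-∷ʳ : ∀ (p : List ℕ) c → length (p ∷ʳ c) ≡ suc (length p)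
length-∷ʳ p c = trans (length-++ p) (+-comm (length p) 1)

Represents-++ˡ : ∀ {m E} p {s} → m ≤ length p → Represents m E (p ++ s) → Represents m E p
Represents-++ˡ p m≤p rep = represents λ a<m b<m →
  trans (cong₂ _≡ᵇ_ (sym (labelAt-++ˡ p (<-≤-trans a<m m≤p))) (sym (labelAt-++ˡ p (<-≤-trans b<m m≤p))))
        (sameL≡ rep a<m b<m)

record UsesExactly (p : List ℕ) (u : ℕ) : Set where
  field
    bounded : ∀ {a} → a < length p → labelAt p a < u
    covers  : ∀ {c} → c < u → ∃ λ a → a < length p × labelAt p a ≡ c

nextUsed : ℕ → ℕ → ℕ
nextUsed u c = if c ≡ᵇ u then suc u else u

module _ (p : List ℕ) (c : ℕ) where

  labelAt-∷ʳ-bound : ∀ {u} → (∀ {a} → a < length p → labelAt p a < u) → c < u →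
                     ∀ {a} → a < length (p ∷ʳ c) → labelAt (p ∷ʳ c) a < u
  labelAt-∷ʳ-bound below c<u a<pc with m<1+n⇒m<n∨m≡n (subst (_ <_) (length-∷ʳ p c) a<pc)
  ... | inj₁ a<p  = subst (_< _) (sym (labelAt-++ˡ p a<p)) (below a<p)
  ... | inj₂ refl = subst (_< _) (sym (labelAt-length p)) c<u

  labelAt-∷ʳ-cover : ∀ {c'} → (∃ λ a → a < length p × labelAt p a ≡ c') →
                     ∃ λ a → a < length (p ∷ʳ c) × labelAt (p ∷ʳ c) a ≡ c'
  labelAt-∷ʳ-cover (a , a<p , eq) =
    a , subst (a <_) (sym (length-∷ʳ p c)) (m<n⇒m<1+n a<p) , trans (labelAt-++ˡ p a<p) eq

UsesExactly-∷ʳ : ∀ {p u c} → UsesExactly p u → c ≤ u → UsesExactly (p ∷ʳ c) (nextUsed u c)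
UsesExactly-∷ʳ {p} {u} {c} uses c≤u with m≤n⇒m<n∨m≡n c≤u
... | inj₁ c<u rewrite to T-not-≡ (≢⇒T-not-≡ᵇ (<⇒≢ c<u)) = record
  { bounded = labelAt-∷ʳ-bound p c bounded c<u
  ; covers  = labelAt-∷ʳ-cover p c ∘ covers }
  where open UsesExactly uses
... | inj₂ refl rewrite to T-≡ (≡⇒≡ᵇ u u refl) = record
  { bounded = labelAt-∷ʳ-bound p u (m<n⇒m<1+n ∘ bounded) (n<1+n u)
  ; covers  = covers′ }
  where
  open UsesExactly uses
  covers′ : ∀ {c'} → c' < suc u → ∃ λ a → a < length (p ∷ʳ u) × labelAt (p ∷ʳ u) a ≡ c'
  covers′ c'<1+u with m<1+n⇒m<n∨m≡n c'<1+u
  ... | inj₁ c'<u = labelAt-∷ʳ-cover p u (covers c'<u)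
  ... | inj₂ refl = length p , subst (length p <_) (sym (length-∷ʳ p u)) (n<1+n _) , labelAt-length p

module _ {E : BoolRel} {p : List ℕ} {u : ℕ} (rep : Represents (length p) E p) (uses : UsesExactly p u) where
  open UsesExactly uses

  private
    sameL-∷ʳ : ∀ {a c} → a < length p → sameL (p ∷ʳ c) a (length p) ≡ (labelAt p a ≡ᵇ c)
    sameL-∷ʳ a<p = cong₂ _≡ᵇ_ (labelAt-++ˡ p a<p) (labelAt-length p)

    extend : ∀ {c} → IsEquivOn (suc (length p)) E →
             (∀ {a} → a < length p → (labelAt p a ≡ᵇ c) ≡ E a (length p)) →
             Represents (suc (length p)) E (p ∷ʳ c)
    extend {c} equiv new = represents extended
      where
      extended : ∀ {a b} → a < suc (length p) → b < suc (length p) → sameL (p ∷ʳ c) a b ≡ E a b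
      extended {a} {b} a<1+p b<1+p with m<1+n⇒m<n∨m≡n a<1+p | m<1+n⇒m<n∨m≡n b<1+p
      ... | inj₁ a<p  | inj₁ b<p  =
        trans (cong₂ _≡ᵇ_ (labelAt-++ˡ p a<p) (labelAt-++ˡ p b<p)) (sameL≡ rep a<p b<p)
      ... | inj₁ a<p  | inj₂ refl = trans (sameL-∷ʳ a<p) (new a<p)
      ... | inj₂ refl | inj₁ b<p  = trans (sameL-sym (p ∷ʳ c) _ b) (trans (trans (sameL-∷ʳ b<p) (new b<p))
                                      (IsEquivOn.symmetric-≡ equiv b<1+p a<1+p))
      ... | inj₂ refl | inj₂ refl = sym (T-injective (λ _ → sameL-refl (p ∷ʳ c) _)
                                                     (λ _ → IsEquivOn.reflexive equiv a<1+p))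

  extension-exists : IsEquivOn (suc (length p)) E → ∃ λ c → c ≤ u × Represents (suc (length p)) E (p ∷ʳ c)
  extension-exists equiv with any? (λ a → T? (E a (length p))) (upTo (length p))
  ... | yes related =
    let a₀ , a₀∈ , a₀~p = find related; a₀<p = ∈-upTo⁻ a₀∈ in
    labelAt p a₀ , <⇒≤ (bounded a₀<p) , extend equiv λ a<p →
      T-injective (λ a~a₀ → transitive (m<n⇒m<1+n a<p) (m<n⇒m<1+n a₀<p) (n<1+n _)
                               (subst T (sameL≡ rep a<p a₀<p) a~a₀) a₀~p)
                  (λ a~p → subst T (sym (sameL≡ rep a<p a₀<p))
                             (transitive (m<n⇒m<1+n a<p) (n<1+n _) (m<n⇒m<1+n a₀<p)
                               a~p (symmetric (m<n⇒m<1+n a₀<p) (n<1+n _) a₀~p)))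
    where open IsEquivOn equiv
  ... | no unrelated =
    u , ≤-refl , extend equiv λ a<p →
      trans (to T-not-≡ (≢⇒T-not-≡ᵇ (<⇒≢ (bounded a<p))))
            (sym (to T-not-≡ (T-not⁺ (unrelated ∘ lose (∈-upTo⁺ a<p)))))

  extension-unique : ∀ {c c'} → c ≤ u → c' ≤ u →
    Represents (suc (length p)) E (p ∷ʳ c) → Represents (suc (length p)) E (p ∷ʳ c') → c ≡ c'
  extension-unique {c} {c'} c≤u c'≤u repc repc' with any? (λ a → T? (E a (length p))) (upTo (length p))
  ... | yes related =
    let a₀ , a₀∈ , a₀~p = find related in
    trans (sym (old a₀~p (∈-upTo⁻ a₀∈) repc)) (old a₀~p (∈-upTo⁻ a₀∈) repc')
    where
    old : ∀ {a₀ d} → T (E a₀ (length p)) → a₀ < length p → Represents (suc (length p)) E (p ∷ʳ d) →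
          labelAt p a₀ ≡ d
    old a₀~p a₀<p repd =
      ≡ᵇ⇒≡ _ _ (subst T (trans (sym (sameL≡ repd (m<n⇒m<1+n a₀<p) (n<1+n _))) (sameL-∷ʳ a₀<p)) a₀~p)
  ... | no unrelated = trans (fresh c≤u repc) (sym (fresh c'≤u repc'))
    where
    fresh : ∀ {d} → d ≤ u → Represents (suc (length p)) E (p ∷ʳ d) → d ≡ u
    fresh {d} d≤u repd with m≤n⇒m<n∨m≡n d≤u
    ... | inj₂ d≡u = d≡u
    ... | inj₁ d<u =
      let a , a<p , a↦d = covers d<u in
      ⊥-elim (unrelated (lose (∈-upTo⁺ a<p)
        (subst T (trans (sym (sameL-∷ʳ a<p)) (sameL≡ repd (m<n⇒m<1+n a<p) (n<1+n _)))
                 (≡⇒≡ᵇ _ _ a↦d))))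

-- The label of the next point is forced: that of an earlier E-related point, or
-- the fresh label u if there is none.
rgsFrom-represents-once : ∀ k {n E p u} → length p + k ≡ n → IsEquivOn n E →
  Represents (length p) E p → UsesExactly p u →
  countB (λ s → representsᵇ n E (p ++ s)) (rgsFrom k u) ≡ 1
rgsFrom-represents-once zero {n} {E} {p} len _ rep _ =
  countB-≡1 (λ s → representsᵇ n E (p ++ s)) (All.[] ∷ []) (here refl) (representsᵇ⁺ {s = p ++ []} complete)
    λ { (here refl) _ → refl }
  where
  complete : Represents n E (p ++ [])
  complete rewrite ++-identityʳ p | sym len | +-identityʳ (length p) = rep
rgsFrom-represents-once (suc k) {n} {E} {p} {u} len equiv rep uses =
  countB-concatMap-≡1 P {g = λ d → map (d ∷_) (rgsFrom k (nextUsed u d))}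
    (upTo⁺ (suc u)) (∈-upTo⁺ (s≤s c≤u)) chosen others
  where
  P : List ℕ → Bool
  P s = representsᵇ n E (p ++ s)
  1+p≤n : suc (length p) ≤ n
  1+p≤n = subst (suc (length p) ≤_) (trans (sym (+-suc (length p) k)) len) (s≤s (m≤m+n (length p) k))
  extension = extension-exists rep uses (IsEquivOn-mono 1+p≤n equiv)
  c = proj₁ extension
  c≤u = proj₁ (proj₂ extension)
  prefix : ∀ {d s} → T (P (d ∷ s)) → Represents (suc (length p)) E (p ∷ʳ d)
  prefix {d} {s} ok = Represents-++ˡ (p ∷ʳ d) {s} (≤-reflexive (sym (length-∷ʳ p d)))
    (Represents-mono {s = p ∷ʳ d ++ s} 1+p≤n
      (subst (Represents n E) (sym (∷ʳ-++ p d s)) (representsᵇ⁻ {s = p ++ d ∷ s} ok)))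
  chosen : countB P (map (c ∷_) (rgsFrom k (nextUsed u c))) ≡ 1
  chosen = trans (countB-map P (c ∷_) (rgsFrom k (nextUsed u c)))
    (trans (countB-cong _ {xs = rgsFrom k (nextUsed u c)} (λ {s} _ → cong (representsᵇ n E) (sym (∷ʳ-++ p c s))))
      (rgsFrom-represents-once k (trans (cong (_+ k) (length-∷ʳ p c)) (trans (sym (+-suc _ k)) len)) equiv
        (subst (λ m → Represents m E (p ∷ʳ c)) (sym (length-∷ʳ p c)) (proj₂ (proj₂ extension)))
        (UsesExactly-∷ʳ uses c≤u)))
  others : ∀ {d} → d ∈ upTo (suc u) → d ≢ c → countB P (map (d ∷_) (rgsFrom k (nextUsed u d))) ≡ 0
  others {d} d∈ d≢c = trans (countB-map P (d ∷_) (rgsFrom k (nextUsed u d)))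
    (countB-≡0 _ {rgsFrom k (nextUsed u d)} λ {s} _ ok →
      d≢c (extension-unique rep uses (m<1+n⇒m≤n (∈-upTo⁻ d∈)) c≤u (prefix {s = s} ok) (proj₂ (proj₂ extension))))

allPartitions-represents-once : ∀ {n E} → IsEquivOn n E → countB (representsᵇ n E) (allPartitions n) ≡ 1
allPartitions-represents-once {n} equiv =
  rgsFrom-represents-once n {p = []} {u = 0} refl equiv (represents λ ()) (record { bounded = λ () ; covers = λ () })

allPartitions-represents : ∀ {n E} → IsEquivOn n E → ∃ λ s → s ∈ allPartitions n × Represents n E s
allPartitions-represents equiv =
  let s , s∈ , ok = countB-≡1-witness _ (allPartitions-represents-once equiv) in s , s∈ , representsᵇ⁻ {s = s} ok

NonCrossing : ℕ → BoolRel → Set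
NonCrossing k R = ∀ {a b c d} → a < b → b < c → c < d → d < k → T (R a c) → T (R b d) → T (R a b)

module _ {k : ℕ} {R : BoolRel} where

  nonCrossing⁻ : T (nonCrossing k R) → NonCrossing k R
  nonCrossing⁻ ok {a} {b} {c} {d} a<b b<c c<d d<k ac bd with R a b in ab
  ... | true  = tt
  ... | false = T-not⁻ noCrossing
    (from T-∧ (<⇒<ᵇ a<b , from T-∧ (<⇒<ᵇ b<c , from T-∧ (<⇒<ᵇ c<d ,
      from T-∧ (ac , from T-∧ (bd , subst (T ∘ not) (sym ab) tt))))))
    where
    c<k = <-trans c<d d<k
    b<k = <-trans b<c c<k
    noCrossing =
      all-upTo⁻ _ {k} (all-upTo⁻ _ {k} (all-upTo⁻ _ {k} (all-upTo⁻ _ {k} ok (<-trans a<b b<k)) b<k) c<k) d<k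

  nonCrossing⁺ : NonCrossing k R → T (nonCrossing k R)
  nonCrossing⁺ nc =
    all-upTo⁺ _ {k} λ {a} _ → all-upTo⁺ _ {k} λ {b} _ → all-upTo⁺ _ {k} λ {c} _ → all-upTo⁺ _ {k} λ {d} d<k →
    T-not⁺ λ crossing →
      let a<b , rest₁ = to T-∧ crossing; b<c , rest₂ = to T-∧ rest₁; c<d , rest₃ = to T-∧ rest₂
          ac , rest₄ = to T-∧ rest₃; bd , a≁b = to T-∧ rest₄
      in T-not⁻ a≁b (nc (<ᵇ⇒< a b a<b) (<ᵇ⇒< b c b<c) (<ᵇ⇒< c d c<d) d<k ac bd)

NonCrossing-Represents : ∀ {n E s} → Represents n E s → NonCrossing n E → NonCrossing n (sameL s)
NonCrossing-Represents rep nc a<b b<c c<d d<n ac bd =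
  subst T (sym (sameL≡ rep a<n b<n))
    (nc a<b b<c c<d d<n (subst T (sameL≡ rep a<n c<n) ac) (subst T (sameL≡ rep b<n d<n) bd))
  where
  c<n = <-trans c<d d<n
  b<n = <-trans b<c c<n
  a<n = <-trans a<b b<n

data Parity : ℕ → Set where
  bar   : ∀ h → Parity (2 * h)
  tilde : ∀ h → Parity (suc (2 * h))

parity : ∀ p → Parity p
parity zero = bar 0
parity (suc p) with parity p
... | bar h   = tilde h
... | tilde h = subst Parity (*-suc 2 h) (bar (suc h))

even?-bar : ∀ h → even? (2 * h) ≡ true
even?-bar h = cong (_≡ᵇ 0) (trans (cong (_% 2) (*-comm 2 h)) (m*n%n≡0 h 2))

even?-tilde : ∀ h → even? (suc (2 * h)) ≡ false
even?-tilde h = cong (_≡ᵇ 0) (trans (cong (λ m → suc m % 2) (*-comm 2 h)) ([m+kn]%n≡m%n 1 h 2))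

half-bar : ∀ h → 2 * h / 2 ≡ h
half-bar h = trans (cong (_/ 2) (*-comm 2 h)) (m*n/n≡m h 2)

half-tilde : ∀ h → suc (2 * h) / 2 ≡ h
half-tilde h = trans (cong (λ m → suc m / 2) (*-comm 2 h))
                     (trans (+-distrib-/-∣ʳ 1 {d = 2} (divides h refl)) (m*n/n≡m h 2))

bar<bar⁻ : ∀ h k → 2 * h < 2 * k → h < k
bar<bar⁻ h k = *-cancelˡ-< 2 h k

bar<tilde⁻ : ∀ h k → 2 * h < suc (2 * k) → h ≤ k
bar<tilde⁻ h k = *-cancelˡ-≤ 2 ∘ m<1+n⇒m≤n

tilde<bar⁻ : ∀ h k → suc (2 * h) < 2 * k → h < k
tilde<bar⁻ h k = bar<bar⁻ h k ∘ <-trans (n<1+n _)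

tilde<tilde⁻ : ∀ h k → suc (2 * h) < suc (2 * k) → h < k
tilde<tilde⁻ h k = bar<bar⁻ h k ∘ s<s⁻¹

bar<bar⁺ : ∀ {h k} → h < k → 2 * h < 2 * k
bar<bar⁺ = *-monoʳ-< 2

bar<tilde⁺ : ∀ {h k} → h ≤ k → 2 * h < suc (2 * k)
bar<tilde⁺ = s≤s ∘ *-monoʳ-≤ 2

tilde<bar⁺ : ∀ {h k} → h < k → suc (2 * h) < 2 * k
tilde<bar⁺ {h} {k} h<k = subst (_≤ 2 * k) (*-suc 2 h) (*-monoʳ-≤ 2 h<k)

module _ (s t : List ℕ) (h k : ℕ) where

  unionRel-bar-bar : unionRel s t (2 * h) (2 * k) ≡ sameL s h k
  unionRel-bar-bar rewrite even?-bar h | even?-bar k | half-bar h | half-bar k = refl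

  unionRel-tilde-tilde : unionRel s t (suc (2 * h)) (suc (2 * k)) ≡ sameL t h k
  unionRel-tilde-tilde rewrite even?-tilde h | even?-tilde k | half-tilde h | half-tilde k = refl

  unionRel-bar-tilde : ¬ T (unionRel s t (2 * h) (suc (2 * k)))
  unionRel-bar-tilde rewrite even?-bar h | even?-tilde k = id

  unionRel-tilde-bar : ¬ T (unionRel s t (suc (2 * h)) (2 * k))
  unionRel-tilde-bar rewrite even?-tilde h | even?-bar k = id

-- The bars 2h < 2k and the tildes 2h'+1 < 2k'+1 alternate around the circle.
data Alternating (h k h' k' : ℕ) : Set where
  bar-first   : h ≤ h' → h' < k → k ≤ k' → Alternating h k h' k'
  tilde-first : h' < h → h ≤ k' → k' < k → Alternating h k h' k'

Alternating⇒< : ∀ {h k h' k'} → Alternating h k h' k' → h < k × h' < k'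
Alternating⇒< (bar-first h≤h' h'<k k≤k')   = ≤-<-trans h≤h' h'<k , <-≤-trans h'<k k≤k'
Alternating⇒< (tilde-first h'<h h≤k' k'<k) = ≤-<-trans h≤k' k'<k , <-≤-trans h'<h h≤k'

Separated : ℕ → BoolRel → BoolRel → Set
Separated n σ τ = ∀ {h k h' k'} → k < n → k' < n → Alternating h k h' k' → T (σ h k) → ¬ T (τ h' k')

module _ {n : ℕ} (s t : List ℕ) where

  unionRel-nonCrossing : NonCrossing n (sameL s) → NonCrossing n (sameL t) → Separated n (sameL s) (sameL t) →
    NonCrossing (2 * n) (unionRel s t)
  unionRel-nonCrossing ncs nct separated {a} {b} {c} {d} =
    crossing (parity a) (parity b) (parity c) (parity d)
    where
    crossing : ∀ {a b c d} → Parity a → Parity b → Parity c → Parity d →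
      a < b → b < c → c < d → d < 2 * n → T (unionRel s t a c) → T (unionRel s t b d) → T (unionRel s t a b)
    crossing (bar h)   _ (tilde k) _ _ _ _ _ ac _ = ⊥-elim (unionRel-bar-tilde s t h k ac)
    crossing (tilde h) _ (bar k)   _ _ _ _ _ ac _ = ⊥-elim (unionRel-tilde-bar s t h k ac)
    crossing _ (bar h)   _ (tilde k) _ _ _ _ _ bd = ⊥-elim (unionRel-bar-tilde s t h k bd)
    crossing _ (tilde h) _ (bar k)   _ _ _ _ _ bd = ⊥-elim (unionRel-tilde-bar s t h k bd)
    crossing (bar h) (bar h') (bar k) (bar k') a<b b<c c<d d<2n ac bd =
      subst T (sym (unionRel-bar-bar s t h h'))
        (ncs (bar<bar⁻ h h' a<b) (bar<bar⁻ h' k b<c) (bar<bar⁻ k k' c<d) (bar<bar⁻ k' n d<2n)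
             (subst T (unionRel-bar-bar s t h k) ac) (subst T (unionRel-bar-bar s t h' k') bd))
    crossing (tilde h) (tilde h') (tilde k) (tilde k') a<b b<c c<d d<2n ac bd =
      subst T (sym (unionRel-tilde-tilde s t h h'))
        (nct (tilde<tilde⁻ h h' a<b) (tilde<tilde⁻ h' k b<c) (tilde<tilde⁻ k k' c<d) (tilde<bar⁻ k' n d<2n)
             (subst T (unionRel-tilde-tilde s t h k) ac) (subst T (unionRel-tilde-tilde s t h' k') bd))
    crossing (bar h) (tilde h') (bar k) (tilde k') a<b b<c c<d d<2n ac bd = ⊥-elim
      (separated (≤-<-trans (bar<tilde⁻ k k' c<d) (tilde<bar⁻ k' n d<2n)) (tilde<bar⁻ k' n d<2n)
        (bar-first (bar<tilde⁻ h h' a<b) (tilde<bar⁻ h' k b<c) (bar<tilde⁻ k k' c<d))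
        (subst T (unionRel-bar-bar s t h k) ac) (subst T (unionRel-tilde-tilde s t h' k') bd))
    crossing (tilde h') (bar h) (tilde k') (bar k) a<b b<c c<d d<2n ac bd = ⊥-elim
      (separated (bar<bar⁻ k n d<2n) (<-trans (tilde<bar⁻ k' k c<d) (bar<bar⁻ k n d<2n))
        (tilde-first (tilde<bar⁻ h' h a<b) (bar<tilde⁻ h k' b<c) (tilde<bar⁻ k' k c<d))
        (subst T (unionRel-bar-bar s t h k) bd) (subst T (unionRel-tilde-tilde s t h' k') ac))

  nonCrossing-unionRel⇒Separated : NonCrossing (2 * n) (unionRel s t) → Separated n (sameL s) (sameL t)
  nonCrossing-unionRel⇒Separated nc {h} {k} {h'} {k'} k<n k'<n (bar-first h≤h' h'<k k≤k') hk h'k' =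
    unionRel-bar-tilde s t h h'
      (nc (bar<tilde⁺ h≤h') (tilde<bar⁺ h'<k) (bar<tilde⁺ k≤k') (tilde<bar⁺ k'<n)
          (subst T (sym (unionRel-bar-bar s t h k)) hk) (subst T (sym (unionRel-tilde-tilde s t h' k')) h'k'))
  nonCrossing-unionRel⇒Separated nc {h} {k} {h'} {k'} k<n k'<n (tilde-first h'<h h≤k' k'<k) hk h'k' =
    unionRel-tilde-bar s t h' h
      (nc (tilde<bar⁺ h'<h) (bar<tilde⁺ h≤k') (tilde<bar⁺ k'<k) (bar<bar⁺ k<n)
          (subst T (sym (unionRel-tilde-tilde s t h' k')) h'k') (subst T (sym (unionRel-bar-bar s t h k)) hk))

module _ {n : ℕ} (s t : List ℕ) where

  private
    coarserIfNonCrossing : List ℕ → Bool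
    coarserIfNonCrossing t' = not (nonCrossing (2 * n) (unionRel s t')) ∨ refines n t' t

  isKreweras⁺ : NonCrossing (2 * n) (unionRel s t) →
    (∀ {t'} → T (nonCrossing (2 * n) (unionRel s t')) →
       ∀ {a b} → a < n → b < n → T (sameL t' a b) → T (sameL t a b)) →
    T (isKreweras n s t)
  isKreweras⁺ nc coarsest = from T-∧ (nonCrossing⁺ nc , all⁻ coarserIfNonCrossing (All.universal (λ t' →
    T-implication⁺ λ nc' → all-upTo⁺ _ {n} λ a<n → all-upTo⁺ _ {n} λ b<n →
      T-implication⁺ (coarsest {t'} nc' a<n b<n)) (allPartitions n)))

  isKreweras⁻ : T (isKreweras n s t) → ∀ {t'} → t' ∈ allPartitions n →
    T (nonCrossing (2 * n) (unionRel s t')) →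
    ∀ {a b} → a < n → b < n → T (sameL t' a b) → T (sameL t a b)
  isKreweras⁻ kre t'∈ nc' a<n b<n =
    T-implication⁻ (all-upTo⁻ _ {n} (all-upTo⁻ _ {n}
      (T-implication⁻ (All.lookup (all⁺ coarserIfNonCrossing _ (proj₂ (to T-∧ kre))) t'∈) nc') a<n) b<n)

total : BoolRel
total _ _ = true

≡ᵇ-isEquivOn : ∀ {n} → IsEquivOn n _≡ᵇ_
≡ᵇ-isEquivOn = record
  { reflexive  = λ {a} _ → ≡⇒≡ᵇ a a refl
  ; symmetric  = λ {a} {b} _ _ ab → ≡⇒≡ᵇ b a (sym (≡ᵇ⇒≡ a b ab))
  ; transitive = λ {a} {b} {c} _ _ _ ab bc → ≡⇒≡ᵇ a c (trans (≡ᵇ⇒≡ a b ab) (≡ᵇ⇒≡ b c bc)) }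

total-isEquivOn : ∀ {n} → IsEquivOn n total
total-isEquivOn = record { reflexive = const tt ; symmetric = λ _ _ _ → tt ; transitive = λ _ _ _ _ _ → tt }

≡ᵇ-nonCrossing : ∀ {n} → NonCrossing n _≡ᵇ_
≡ᵇ-nonCrossing {a = a} {c = c} a<b b<c _ _ ac _ = ⊥-elim (<⇒≢ (<-trans a<b b<c) (≡ᵇ⇒≡ a c ac))

total-nonCrossing : ∀ {n} → NonCrossing n total
total-nonCrossing _ _ _ _ _ _ = tt

isKreweras-discrete : ∀ {n s t} → Represents n _≡ᵇ_ s → Represents n total t → T (isKreweras n s t)
isKreweras-discrete {n} {s} {t} reps rept = isKreweras⁺ s t
  (unionRel-nonCrossing s t (NonCrossing-Represents reps ≡ᵇ-nonCrossing)
                            (NonCrossing-Represents rept total-nonCrossing) separated)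
  (λ _ a<n b<n _ → subst T (sym (sameL≡ rept a<n b<n)) tt)
  where
  separated : Separated n (sameL s) (sameL t)
  separated {h} {k} k<n _ alt hk _ =
    let h<k = proj₁ (Alternating⇒< alt) in
    <⇒≢ h<k (≡ᵇ⇒≡ h k (subst T (sameL≡ reps (<-trans h<k k<n) k<n) hk))

pairRel : ℕ → ℕ → BoolRel
pairRel u v a b = (a ≡ᵇ b) ∨ ((a ≡ᵇ u) ∧ (b ≡ᵇ v)) ∨ ((a ≡ᵇ v) ∧ (b ≡ᵇ u))

data Paired (u v : ℕ) : ℕ → ℕ → Set where
  same : ∀ {a} → Paired u v a a
  fwd  : Paired u v u v
  bwd  : Paired u v v u

module _ {u v : ℕ} where

  pairRel⁻ : ∀ a b → T (pairRel u v a b) → Paired u v a b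
  pairRel⁻ a b ab with to T-∨ ab
  ... | inj₁ a≡b with refl ← ≡ᵇ⇒≡ a b a≡b = same
  ... | inj₂ ab′ with to T-∨ ab′
  ... | inj₁ fwd′ with refl ← ≡ᵇ⇒≡ a u (proj₁ (to T-∧ fwd′)) | refl ← ≡ᵇ⇒≡ b v (proj₂ (to T-∧ fwd′))
    = fwd
  ... | inj₂ bwd′ with refl ← ≡ᵇ⇒≡ a v (proj₁ (to T-∧ bwd′)) | refl ← ≡ᵇ⇒≡ b u (proj₂ (to T-∧ bwd′))
    = bwd

  pairRel⁺ : ∀ {a b} → Paired u v a b → T (pairRel u v a b)
  pairRel⁺ (same {a}) = from (T-∨ {a ≡ᵇ a}) (inj₁ (≡⇒≡ᵇ a a refl))
  pairRel⁺ fwd = from (T-∨ {u ≡ᵇ v}) (inj₂ (from (T-∨ {(u ≡ᵇ u) ∧ (v ≡ᵇ v)})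
                   (inj₁ (from (T-∧ {u ≡ᵇ u}) (≡⇒≡ᵇ u u refl , ≡⇒≡ᵇ v v refl)))))
  pairRel⁺ bwd = from (T-∨ {v ≡ᵇ u}) (inj₂ (from (T-∨ {(v ≡ᵇ u) ∧ (u ≡ᵇ v)})
                   (inj₂ (from (T-∧ {v ≡ᵇ v}) (≡⇒≡ᵇ v v refl , ≡⇒≡ᵇ u u refl)))))

Paired-swap : ∀ {u v a b} → Paired u v a b → Paired v u a b
Paired-swap same = same
Paired-swap fwd  = bwd
Paired-swap bwd  = fwd

pairRel-comm : ∀ u v a b → pairRel u v a b ≡ pairRel v u a b
pairRel-comm u v a b =
  T-injective (pairRel⁺ ∘ Paired-swap ∘ pairRel⁻ a b) (pairRel⁺ ∘ Paired-swap ∘ pairRel⁻ a b)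

pairRel-isEquivOn : ∀ {n u v} → IsEquivOn n (pairRel u v)
pairRel-isEquivOn {u = u} {v} = record
  { reflexive  = λ {a} _ → pairRel⁺ {a = a} same
  ; symmetric  = λ {a} {b} _ _ → pairRel⁺ ∘ flip ∘ pairRel⁻ a b
  ; transitive = λ {a} {b} {c} _ _ _ ab bc → pairRel⁺ (compose (pairRel⁻ a b ab) (pairRel⁻ b c bc)) }
  where
  flip : ∀ {a b} → Paired u v a b → Paired u v b a
  flip same = same
  flip fwd  = bwd
  flip bwd  = fwd
  compose : ∀ {a b c} → Paired u v a b → Paired u v b c → Paired u v a c
  compose same q    = q
  compose p    same = p
  compose fwd  fwd  = same
  compose fwd  bwd  = same
  compose bwd  fwd  = same
  compose bwd  bwd  = same

pairRel-nonCrossing : ∀ {n u v} → NonCrossing n (pairRel u v)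
pairRel-nonCrossing {a = a} {b} {c} {d} a<b b<c c<d _ ac bd =
  ⊥-elim (crossing (pairRel⁻ a c ac) (pairRel⁻ b d bd) a<b b<c c<d)
  where
  crossing : ∀ {u v a b c d} → Paired u v a c → Paired u v b d → a < b → b < c → c < d → ⊥
  crossing same _   a<b b<c _   = <-irrefl refl (<-trans a<b b<c)
  crossing _    same _   b<c c<d = <-irrefl refl (<-trans b<c c<d)
  crossing fwd  fwd  a<b _   _   = <-irrefl refl a<b
  crossing fwd  bwd  _   b<c _   = <-irrefl refl b<c
  crossing bwd  fwd  _   b<c _   = <-irrefl refl b<c
  crossing bwd  bwd  a<b _   _   = <-irrefl refl a<b

pair-partner-unique : ∀ {n k x y s} → k < n → x < n → x ≢ k → y ≢ k →
  Represents n (pairRel k x) s → Represents n (pairRel k y) s → x ≡ y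
pair-partner-unique {k = k} {x} k<n x<n x≢k y≢k repx repy =
  partner (pairRel⁻ k x (subst T (trans (sym (sameL≡ repx k<n x<n)) (sameL≡ repy k<n x<n)) (pairRel⁺ {k} {x} fwd)))
          x≢k y≢k
  where
  partner : ∀ {k x y} → Paired k y k x → x ≢ k → y ≢ k → x ≡ y
  partner same x≢k _   = ⊥-elim (x≢k refl)
  partner fwd  _   _   = refl
  partner bwd  _   y≢k = ⊥-elim (y≢k refl)

-- The complement of the pair partition {lo, hi} has the tildes lo, …, hi-1,
-- which lie between bar lo and bar hi, as one of its two blocks.
module Arc (lo hi : ℕ) where

  inArc : ℕ → Bool
  inArc b = (lo ≤ᵇ b) ∧ (b <ᵇ hi)

  sameSide : BoolRel
  sameSide a b = beq (inArc a) (inArc b)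

  inArc⁺ : ∀ {b} → lo ≤ b → b < hi → T (inArc b)
  inArc⁺ lo≤b b<hi = from T-∧ (≤⇒≤ᵇ lo≤b , <⇒<ᵇ b<hi)

  inArc⁻ : ∀ {b} → T (inArc b) → lo ≤ b × b < hi
  inArc⁻ {b} inside = let lo≤b , b<hi = to T-∧ inside in ≤ᵇ⇒≤ lo b lo≤b , <ᵇ⇒< b hi b<hi

  outsideArc : ∀ {b} → ¬ T (inArc b) → b < lo ⊎ hi ≤ b
  outsideArc {b} outside with b <? lo
  ... | yes b<lo = inj₁ b<lo
  ... | no  b≮lo = inj₂ (≮⇒≥ λ b<hi → outside (inArc⁺ (≮⇒≥ b≮lo) b<hi))

  inArc-convex : ∀ {a b c} → a ≤ b → b ≤ c → T (inArc a) → T (inArc c) → T (inArc b)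
  inArc-convex a≤b b≤c a∈ c∈ =
    inArc⁺ (≤-trans (proj₁ (inArc⁻ a∈)) a≤b) (≤-<-trans b≤c (proj₂ (inArc⁻ c∈)))

  sameSide-isEquivOn : ∀ {n} → IsEquivOn n sameSide
  sameSide-isEquivOn = record
    { reflexive  = λ {a} _ → T-beq⁺ {inArc a} refl
    ; symmetric  = λ {a} {b} _ _ ab → T-beq⁺ (sym (T-beq⁻ {inArc a} ab))
    ; transitive = λ {a} {b} _ _ _ ab bc → T-beq⁺ (trans (T-beq⁻ {inArc a} ab) (T-beq⁻ {inArc b} bc)) }

  sameSide-nonCrossing : ∀ {n} → NonCrossing n sameSide
  sameSide-nonCrossing {a = a} {b} {c} {d} a<b b<c c<d _ ac bd with inArc a in a∈ | inArc b in b∈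
  ... | true  | true  = tt
  ... | false | false = tt
  ... | true  | false = subst T b∈ (inArc-convex (<⇒≤ a<b) (<⇒≤ b<c) (subst T (sym a∈) tt) ac)
  ... | false | true  = T-not⁻ ac (inArc-convex (<⇒≤ b<c) (<⇒≤ c<d) (subst T (sym b∈) tt) bd)

module _ {n lo hi : ℕ} (lo<hi : lo < hi) (hi<n : hi < n) {s : List ℕ} (reps : Represents n (pairRel lo hi) s) where
  open Arc lo hi

  private
    lo~hi : T (sameL s lo hi)
    lo~hi = subst T (sym (sameL≡ reps (<-trans lo<hi hi<n) hi<n)) (pairRel⁺ {lo} {hi} fwd)

  pair-arc-nonCrossing : ∀ {t} → Represents n sameSide t → NonCrossing (2 * n) (unionRel s t)
  pair-arc-nonCrossing {t} rept = unionRel-nonCrossing s t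
    (NonCrossing-Represents reps pairRel-nonCrossing) (NonCrossing-Represents rept sameSide-nonCrossing) separated
    where
    endpoints : ∀ {h k h' k'} → Alternating h k h' k' → Paired lo hi h k → inArc h' ≡ inArc k' → ⊥
    endpoints alt same _ = <-irrefl refl (proj₁ (Alternating⇒< alt))
    endpoints alt bwd  _ = <-asym lo<hi (proj₁ (Alternating⇒< alt))
    endpoints (bar-first lo≤h' h'<hi hi≤k') fwd sides =
      ≤⇒≯ hi≤k' (proj₂ (inArc⁻ (subst T sides (inArc⁺ lo≤h' h'<hi))))
    endpoints (tilde-first h'<lo lo≤k' k'<hi) fwd sides =
      <⇒≱ h'<lo (proj₁ (inArc⁻ (subst T (sym sides) (inArc⁺ lo≤k' k'<hi))))

    separated : Separated n (sameL s) (sameL t)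
    separated {h} {k} {h'} {k'} k<n k'<n alt hk h'k' =
      let h<k , h'<k' = Alternating⇒< alt in
      endpoints alt (pairRel⁻ h k (subst T (sameL≡ reps (<-trans h<k k<n) k<n) hk))
                    (T-beq⁻ {inArc h'} (subst T (sameL≡ rept (<-trans h'<k' k'<n) k'<n) h'k'))

  pair-complement-coarsest : ∀ {t'} → T (nonCrossing (2 * n) (unionRel s t')) →
    ∀ {a b} → a < n → b < n → T (sameL t' a b) → T (sameSide a b)
  pair-complement-coarsest {t'} nc {a} {b} a<n b<n ab = T-beq⁺ {inArc a}
    (T-injective (staysIn a<n b<n ab) (staysIn b<n a<n (subst T (sameL-sym t' a b) ab)))
    where
    separated = nonCrossing-unionRel⇒Separated s t' (nonCrossing⁻ nc)
    staysIn : ∀ {x y} → x < n → y < n → T (sameL t' x y) → T (inArc x) → T (inArc y)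
    staysIn {x} {y} x<n y<n xy x∈ with T? (inArc y) | inArc⁻ x∈
    ... | yes y∈ | _ = y∈
    ... | no  y∉ | lo≤x , x<hi with outsideArc y∉
    ...   | inj₂ hi≤y = ⊥-elim (separated hi<n y<n (bar-first lo≤x x<hi hi≤y) lo~hi xy)
    ...   | inj₁ y<lo = ⊥-elim (separated hi<n x<n (tilde-first y<lo lo≤x x<hi) lo~hi
                                 (subst T (sameL-sym t' x y) xy))

  isKreweras-pair : ∀ {t} → Represents n sameSide t → T (isKreweras n s t)
  isKreweras-pair {t} rept = isKreweras⁺ s t (pair-arc-nonCrossing rept) λ {t'} nc a<n b<n ab →
    subst T (sym (sameL≡ rept a<n b<n)) (pair-complement-coarsest {t'} nc a<n b<n ab)

-- The tildes next to bar j are tilde j and tilde (cycPred n j).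
cycPred : ℕ → ℕ → ℕ
cycPred n zero    = pred n
cycPred n (suc j) = j

cycPred-< : ∀ {n j} → j < n → cycPred n j < n
cycPred-< {suc n} {zero}  _     = n<1+n n
cycPred-< {n}     {suc j} 1+j<n = <-trans (n<1+n j) 1+j<n

cycPred-≢ : ∀ {n j} → 1 < n → j < n → cycPred n j ≢ j
cycPred-≢ {suc n} {zero}  (s≤s 0<n) _ = <⇒≢ 0<n ∘ sym
cycPred-≢ {n}     {suc j} _         _ = <⇒≢ (n<1+n j)

module _ {n lo hi : ℕ} (lo<hi : lo < hi) (hi<n : hi < n) where
  open Arc lo hi

  private
    below : ∀ {b} → b < lo → inArc b ≡ false
    below b<lo = to T-not-≡ (T-not⁺ (<⇒≱ b<lo ∘ proj₁ ∘ inArc⁻))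

    above : ∀ {b} → hi ≤ b → inArc b ≡ false
    above hi≤b = to T-not-≡ (T-not⁺ (≤⇒≯ hi≤b ∘ proj₂ ∘ inArc⁻))

    inside : ∀ {b} → lo ≤ b → b < hi → inArc b ≡ true
    inside lo≤b b<hi = to T-≡ (inArc⁺ lo≤b b<hi)

    hi≤last : hi ≤ pred n
    hi≤last = <⇒≤pred hi<n

    true≢false : ∀ {x y} → x ≡ true → y ≡ false → x ≢ y
    true≢false refl refl ()

  inArc-cycPred-endpoint : ∀ j → j ≡ lo ⊎ j ≡ hi → inArc j ≢ inArc (cycPred n j)
  inArc-cycPred-endpoint zero    (inj₁ refl) = true≢false (inside ≤-refl lo<hi) (above hi≤last)
  inArc-cycPred-endpoint zero    (inj₂ refl) = ⊥-elim (n≮0 lo<hi)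
  inArc-cycPred-endpoint (suc j) (inj₁ refl) = true≢false (inside ≤-refl lo<hi) (below ≤-refl)
  inArc-cycPred-endpoint (suc j) (inj₂ refl) = true≢false (inside (≤-pred lo<hi) ≤-refl) (above ≤-refl) ∘ sym

  inArc-cycPred-interior : ∀ j → j ≢ lo → j ≢ hi → inArc j ≡ inArc (cycPred n j)
  inArc-cycPred-interior zero    0≢lo _ = trans (below (n≢0⇒n>0 (0≢lo ∘ sym))) (sym (above hi≤last))
  inArc-cycPred-interior (suc j) j≢lo j≢hi with j <? lo | j <? hi
  ... | yes j<lo | _        = trans (below (≤∧≢⇒< j<lo j≢lo)) (sym (below j<lo))
  ... | no  j≮lo | yes j<hi = trans (inside (m≤n⇒m≤1+n (≮⇒≥ j≮lo)) (≤∧≢⇒< j<hi j≢hi))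
                                    (sym (inside (≮⇒≥ j≮lo) j<hi))
  ... | no  _    | no  j≮hi = trans (above (m≤n⇒m≤1+n (≮⇒≥ j≮hi))) (sym (above (≮⇒≥ j≮hi)))

record OnePerBlock (n : ℕ) (R : BoolRel) (out : ℕ → Bool) : Set where
  constructor onePerBlock
  field count≡1 : ∀ {a} → a < n → countB (λ b → R a b ∧ out b) (upTo n) ≡ 1
open OnePerBlock

module _ {n : ℕ} {R : BoolRel} {out : ℕ → Bool} where

  OnePerBlock⁺ : (∀ {a} → a < n → ∃ λ w → w < n × T (R a w ∧ out w) ×
                   (∀ {b} → b < n → T (R a b ∧ out b) → b ≡ w)) →
                 OnePerBlock n R out
  OnePerBlock⁺ unique = onePerBlock λ a<n →
    let w , w<n , w∈ , only = unique a<n in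
    countB-≡1 (λ b → R _ b ∧ out b) (upTo⁺ n) (∈-upTo⁺ w<n) w∈ (only ∘ ∈-upTo⁻)

  OnePerBlock-witness : OnePerBlock n R out → ∀ {a} → a < n → ∃ λ w → w < n × T (R a w ∧ out w)
  OnePerBlock-witness one {a} a<n =
    let w , w∈ , ok = countB-≡1-witness (λ b → R a b ∧ out b) (count≡1 one a<n) in w , ∈-upTo⁻ w∈ , ok

  OnePerBlock-unique : OnePerBlock n R out → ∀ {a x y} → a < n → x < n → y < n →
                       T (R a x ∧ out x) → T (R a y ∧ out y) → x ≡ y
  OnePerBlock-unique one {a} a<n x<n y<n =
    countB-≡1-unique (λ b → R a b ∧ out b) (count≡1 one a<n) (∈-upTo⁺ x<n) (∈-upTo⁺ y<n)

  OnePerBlock-cong : ∀ {R' out'} → (∀ {a b} → a < n → b < n → R a b ≡ R' a b) →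
                     (∀ {b} → b < n → out b ≡ out' b) → OnePerBlock n R out → OnePerBlock n R' out'
  OnePerBlock-cong R≡ out≡ one = onePerBlock λ {a} a<n →
    trans (sym (countB-cong _ λ b∈ → let b<n = ∈-upTo⁻ b∈ in cong₂ _∧_ (R≡ a<n b<n) (out≡ b<n)))
          (count≡1 one a<n)

module _ {n : ℕ} {s : List ℕ} {out : ℕ → Bool} (allMarked : ∀ {b} → b < n → T (out b)) where

  OnePerBlock⇒discrete : OnePerBlock n (sameL s) out → Represents n _≡ᵇ_ s
  OnePerBlock⇒discrete one = represents λ {a} {b} a<n b<n → T-injective
    (λ ab → ≡⇒≡ᵇ a b (OnePerBlock-unique one a<n a<n b<n
                        (from T-∧ (sameL-refl s a , allMarked a<n)) (from T-∧ (ab , allMarked b<n))))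
    (λ a≡b → subst (T ∘ sameL s a) (≡ᵇ⇒≡ a b a≡b) (sameL-refl s a))

  discrete⇒OnePerBlock : Represents n _≡ᵇ_ s → OnePerBlock n (sameL s) out
  discrete⇒OnePerBlock rep = OnePerBlock⁺ λ {a} a<n →
    a , a<n , from T-∧ (sameL-refl s a , allMarked a<n) ,
    λ {b} b<n ab → sym (≡ᵇ⇒≡ a b (subst T (sameL≡ rep a<n b<n) (proj₁ (to T-∧ ab))))

module _ {n : ℕ} {s : List ℕ} {i : ℕ} (i<n : i < n) where

  private
    allBut : ℕ → Bool
    allBut b = not (b ≡ᵇ i)

  OnePerBlock-except⇒pair : OnePerBlock n (sameL s) allBut →
                            ∃ λ x → x < n × x ≢ i × Represents n (pairRel i x) s
  OnePerBlock-except⇒pair one =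
    x , x<n , x≢i , represents λ {a} {b} a<n b<n →
      T-injective (pairRel⁺ ∘ paired a<n b<n) (sameL-paired ∘ pairRel⁻ a b)
    where
    partner = OnePerBlock-witness one i<n
    x = proj₁ partner
    x<n = proj₁ (proj₂ partner)
    x-marked = proj₂ (proj₂ partner)
    i~x = proj₁ (to T-∧ x-marked)
    x≢i : x ≢ i
    x≢i x≡i = T-not⁻ (proj₂ (to T-∧ x-marked)) (≡⇒≡ᵇ x i x≡i)
    marked : ∀ {a b} → T (sameL s a b) → b ≢ i → T (sameL s a b ∧ allBut b)
    marked ab b≢i = from T-∧ (ab , ≢⇒T-not-≡ᵇ b≢i)
    sameL-paired : ∀ {a b} → Paired i x a b → T (sameL s a b)
    sameL-paired (same {a}) = sameL-refl s a
    sameL-paired fwd = i~x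
    sameL-paired bwd = subst T (sameL-sym s i x) i~x
    paired : ∀ {a b} → a < n → b < n → T (sameL s a b) → Paired i x a b
    paired {a} {b} a<n b<n ab with a ≟ b | a ≟ i | b ≟ i
    ... | yes refl | _        | _        = same
    ... | no a≢b   | yes refl | _        =
      subst (Paired i x i) (OnePerBlock-unique one i<n x<n b<n x-marked (marked ab (a≢b ∘ sym))) fwd
    ... | no a≢b   | no a≢i   | yes refl =
      subst (λ c → Paired i x c i) (OnePerBlock-unique one i<n x<n a<n x-marked
        (marked (subst T (sameL-sym s a i) ab) a≢i)) bwd
    ... | no a≢b   | no a≢i   | no b≢i   =
      ⊥-elim (a≢b (OnePerBlock-unique one a<n a<n b<n (marked (sameL-refl s a) a≢i) (marked ab b≢i)))

  pair⇒OnePerBlock-except : ∀ {x} → x < n → x ≢ i → Represents n (pairRel i x) s →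
                            OnePerBlock n (sameL s) allBut
  pair⇒OnePerBlock-except {x} x<n x≢i rep = OnePerBlock⁺ λ {a} a<n → representative a<n (a ≟ i)
    where
    paired : ∀ {a b} → a < n → b < n → T (sameL s a b ∧ allBut b) → Paired i x a b × b ≢ i
    paired {a} {b} a<n b<n ab =
      let a~b , b≢i = to T-∧ ab in
      pairRel⁻ a b (subst T (sameL≡ rep a<n b<n) a~b) , T-not⁻ b≢i ∘ ≡⇒≡ᵇ b i
    representative : ∀ {a} → a < n → Dec (a ≡ i) →
      ∃ λ w → w < n × T (sameL s a w ∧ allBut w) ×
              (∀ {b} → b < n → T (sameL s a b ∧ allBut b) → b ≡ w)
    representative {a} a<n (yes refl) =
      x , x<n , from T-∧ (subst T (sym (sameL≡ rep i<n x<n)) (pairRel⁺ {i} {x} fwd) , ≢⇒T-not-≡ᵇ x≢i) ,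
      λ b<n ab → case (paired a<n b<n ab)
      where
      case : ∀ {b} → Paired i x i b × b ≢ i → b ≡ x
      case (same , b≢i) = ⊥-elim (b≢i refl)
      case (fwd  , _)   = refl
      case (bwd  , _)   = ⊥-elim (x≢i refl)
    representative {a} a<n (no a≢i) =
      a , a<n , from T-∧ (sameL-refl s a , ≢⇒T-not-≡ᵇ a≢i) , λ b<n ab → case (paired a<n b<n ab)
      where
      case : ∀ {b} → Paired i x a b × b ≢ i → b ≡ a
      case (same , _)   = refl
      case (fwd  , _)   = ⊥-elim (a≢i refl)
      case (bwd  , b≢i) = ⊥-elim (b≢i refl)

nextTo : ℕ → ℕ → ℕ → Bool
nextTo n j b = (b ≡ᵇ j) ∨ (b ≡ᵇ cycPred n j)

module _ {n lo hi : ℕ} (lo<hi : lo < hi) (hi<n : hi < n) {j : ℕ} (j<n : j < n) where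
  open Arc lo hi

  private
    pj<n = cycPred-< j<n
    j-nextTo : T (nextTo n j j)
    j-nextTo = from (T-∨ {j ≡ᵇ j}) (inj₁ (≡⇒≡ᵇ j j refl))
    pj-nextTo : T (nextTo n j (cycPred n j))
    pj-nextTo = from (T-∨ {cycPred n j ≡ᵇ j}) (inj₂ (≡⇒≡ᵇ (cycPred n j) _ refl))
    nextTo⁻ : ∀ {b} → T (nextTo n j b) → b ≡ j ⊎ b ≡ cycPred n j
    nextTo⁻ {b} near with to (T-∨ {b ≡ᵇ j}) near
    ... | inj₁ b≡j  = inj₁ (≡ᵇ⇒≡ b j b≡j)
    ... | inj₂ b≡pj = inj₂ (≡ᵇ⇒≡ b _ b≡pj)

  endpoint⇒OnePerBlock : j ≡ lo ⊎ j ≡ hi → OnePerBlock n sameSide (nextTo n j)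
  endpoint⇒OnePerBlock endpoint = OnePerBlock⁺ λ {a} a<n → side a<n (inArc a ≟ᵇ inArc j)
    where
    separated = inArc-cycPred-endpoint lo<hi hi<n j endpoint
    side : ∀ {a} → a < n → Dec (inArc a ≡ inArc j) →
      ∃ λ w → w < n × T (sameSide a w ∧ nextTo n j w) ×
              (∀ {b} → b < n → T (sameSide a b ∧ nextTo n j b) → b ≡ w)
    side {a} a<n (yes a~j) = j , j<n , from T-∧ (T-beq⁺ a~j , j-nextTo) , λ {b} _ ab →
      let a~b , near = to T-∧ ab in case (nextTo⁻ near) (T-beq⁻ {inArc a} a~b)
      where
      case : ∀ {b} → b ≡ j ⊎ b ≡ cycPred n j → inArc a ≡ inArc b → b ≡ j
      case (inj₁ b≡j) _ = b≡j
      case (inj₂ refl) a~pj = ⊥-elim (separated (trans (sym a~j) a~pj))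
    side {a} a<n (no a≁j) =
      cycPred n j , pj<n , from T-∧ (T-beq⁺ (trans (¬-not a≁j) (sym (¬-not (separated ∘ sym)))) , pj-nextTo) ,
      λ {b} _ ab →
      let a~b , near = to T-∧ ab in case (nextTo⁻ near) (T-beq⁻ {inArc a} a~b)
      where
      case : ∀ {b} → b ≡ j ⊎ b ≡ cycPred n j → inArc a ≡ inArc b → b ≡ cycPred n j
      case (inj₁ refl) a~j = ⊥-elim (a≁j a~j)
      case (inj₂ b≡pj) _ = b≡pj

  coarser-OnePerBlock⇒endpoint : ∀ {R} → (∀ {a b} → a < n → b < n → T (sameSide a b) → T (R a b)) →
                                 OnePerBlock n R (nextTo n j) → j ≡ lo ⊎ j ≡ hi
  coarser-OnePerBlock⇒endpoint coarser one with j ≟ lo | j ≟ hi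
  ... | yes j≡lo | _        = inj₁ j≡lo
  ... | no  _    | yes j≡hi = inj₂ j≡hi
  ... | no  j≢lo | no  j≢hi = ⊥-elim (cycPred-≢ 1<n j<n (sym
    (OnePerBlock-unique one j<n j<n pj<n (from T-∧ (coarser j<n j<n (T-beq⁺ {inArc j} refl) , j-nextTo))
      (from T-∧ (coarser j<n pj<n (T-beq⁺ (inArc-cycPred-interior lo<hi hi<n j j≢lo j≢hi)) , pj-nextTo)))))
    where
    1<n : 1 < n
    1<n = ≤-<-trans (≤-trans (s≤s z≤n) lo<hi) hi<n

barOut tildeOut : ∀ n → Subset (2 * n) → ℕ → Bool
barOut   n I b = not (memI {n} I (2 * b))
tildeOut n I b = not (memI {n} I (suc (2 * b)))

module _ {n : ℕ} (I : Subset (2 * n)) where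

  blocksOK⁻ : ∀ pt s → T (blocksOK {n} I pt s) → OnePerBlock n (sameL s) (λ b → not (memI {n} I (pt b)))
  blocksOK⁻ _ _ ok = onePerBlock λ a<n → ≡ᵇ⇒≡ _ 1 (all-upTo⁻ _ {n} ok a<n)

  blocksOK⁺ : ∀ pt s → OnePerBlock n (sameL s) (λ b → not (memI {n} I (pt b))) → T (blocksOK {n} I pt s)
  blocksOK⁺ _ _ one = all-upTo⁺ _ {n} λ a<n → ≡⇒≡ᵇ _ 1 (count≡1 one a<n)

  concordant⁻ : ∀ s → T (concordant {n} I s) →
    ∃ λ t → t ∈ allPartitions n × T (isKreweras n s t) ×
            OnePerBlock n (sameL s) (barOut n I) × OnePerBlock n (sameL t) (tildeOut n I)
  concordant⁻ s ok =
    let t , t∈ , witness = find (any⁻ _ _ ok)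
        kre , blocks = to T-∧ witness
        bars , tildes = to T-∧ blocks
    in t , t∈ , kre , blocksOK⁻ (2 *_) s bars , blocksOK⁻ (λ b → suc (2 * b)) t tildes

  concordant⁺ : ∀ s {t} → t ∈ allPartitions n → T (isKreweras n s t) →
    OnePerBlock n (sameL s) (barOut n I) → OnePerBlock n (sameL t) (tildeOut n I) → T (concordant {n} I s)
  concordant⁺ s {t} t∈ kre bars tildes =
    any⁺ _ (lose t∈ (from T-∧ (kre ,
      from T-∧ (blocksOK⁺ (2 *_) s bars , blocksOK⁺ (λ b → suc (2 * b)) t tildes))))

lookupℕ : ∀ {m} → Vec Bool m → ℕ → Bool
lookupℕ []ᵥ       _       = false
lookupℕ (x ∷ᵥ v) zero    = x
lookupℕ (x ∷ᵥ v) (suc p) = lookupℕ v p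

lookupℕ-toℕ : ∀ {m} (v : Vec Bool m) q → lookupℕ v (toℕ q) ≡ lookup v q
lookupℕ-toℕ (x ∷ᵥ v) Fin.zero    = refl
lookupℕ-toℕ (x ∷ᵥ v) (Fin.suc q) = lookupℕ-toℕ v q

lookupℕ-< : ∀ {m} (v : Vec Bool m) {p} → T (lookupℕ v p) → p < m
lookupℕ-< (x ∷ᵥ v) {zero}  _ = z<s
lookupℕ-< (x ∷ᵥ v) {suc p} p∈ = s<s (lookupℕ-< v p∈)

lookupℕ-fromℕ< : ∀ {m} (v : Vec Bool m) {p} (p<m : p < m) → lookupℕ v p ≡ lookup v (fromℕ< p<m)
lookupℕ-fromℕ< v p<m = trans (cong (lookupℕ v) (sym (toℕ-fromℕ< p<m))) (lookupℕ-toℕ v (fromℕ< p<m))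

lookupℕ-tabulate : ∀ {m} (f : ℕ → Bool) {p} → p < m → lookupℕ (tabulate {n = m} (f ∘ toℕ)) p ≡ f p
lookupℕ-tabulate {m} f p<m =
  trans (lookupℕ-fromℕ< (tabulate {n = m} (f ∘ toℕ)) p<m)
        (trans (lookup∘tabulate (f ∘ toℕ) (fromℕ< p<m)) (cong f (toℕ-fromℕ< p<m)))

lookupℕ-⊆ : ∀ {m} {R S : Subset m} → R ⊆ S → ∀ {p} → T (lookupℕ R p) → T (lookupℕ S p)
lookupℕ-⊆ {R = R} {S} R⊆S {p} p∈R =
  let p<m = lookupℕ-< R p∈R
      q∈S = R⊆S (lookup⇒[]= (fromℕ< p<m) R (trans (sym (lookupℕ-fromℕ< R p<m)) (to T-≡ p∈R)))
  in subst T (sym (trans (lookupℕ-fromℕ< S p<m) ([]=⇒lookup q∈S))) tt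

memI≡lookupℕ : ∀ {n} (I : Subset (2 * n)) p → memI {n} I p ≡ lookupℕ I p
memI≡lookupℕ {n} I p = T-injective
  (λ p∈ → let q , _ , q∈ = find (any⁻ hit (allFin (2 * n)) p∈); q≡p , q∈I = to T-∧ q∈ in
          subst T (trans (sym (lookupℕ-toℕ I q)) (cong (lookupℕ I) (≡ᵇ⇒≡ (toℕ q) p q≡p))) q∈I)
  (λ p∈ → let p< = lookupℕ-< I p∈; q = fromℕ< p< in
          any⁺ hit (lose (∈-allFin q) (from T-∧ (≡⇒≡ᵇ (toℕ q) p (toℕ-fromℕ< p<) ,
            subst T (lookupℕ-fromℕ< I p<) p∈))))
  where
  hit : Fin (2 * n) → Bool
  hit q = (toℕ q ≡ᵇ p) ∧ lookup I q

∣∣≡countB-lookupℕ : ∀ {m} (v : Vec Bool m) → ∣ v ∣ ≡ countB (lookupℕ v) (upTo m)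
∣∣≡countB-lookupℕ []ᵥ = refl
∣∣≡countB-lookupℕ {suc m} (x ∷ᵥ v) = begin
  ∣ x ∷ᵥ v ∣                                                  ≡⟨ count-∷ x ⟩
  (if x then suc ∣ v ∣ else ∣ v ∣)                            ≡⟨ cong (λ c → if x then suc c else c) rest ⟩
  (if x then suc (countB (lookupℕ (x ∷ᵥ v)) (applyUpTo suc m))
        else countB (lookupℕ (x ∷ᵥ v)) (applyUpTo suc m))     ∎
  where
  open ≡-Reasoning
  count-∷ : ∀ x → ∣ x ∷ᵥ v ∣ ≡ (if x then suc ∣ v ∣ else ∣ v ∣)
  count-∷ true  = refl
  count-∷ false = refl
  rest : ∣ v ∣ ≡ countB (lookupℕ (x ∷ᵥ v)) (applyUpTo suc m)
  rest = trans (∣∣≡countB-lookupℕ v)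
    (trans (sym (countB-map (lookupℕ (x ∷ᵥ v)) suc (upTo m))) (cong (countB _) (map-applyUpTo id suc m)))

module _ {n : ℕ} {R : Subset (2 * n)} (R⊆evens : R ⊆ evenIdx n) where

  private
    noBar : ∀ b → ¬ T (lookupℕ R (2 * b))
    noBar b 2b∈R = subst (T ∘ not) (even?-bar b)
      (subst T (lookupℕ-tabulate (not ∘ even?) (lookupℕ-< R 2b∈R)) (lookupℕ-⊆ R⊆evens 2b∈R))

    inTilde : ℕ → Bool
    inTilde b = lookupℕ R (suc (2 * b))

  evens-barOut : ∀ b → barOut n R b ≡ true
  evens-barOut b = cong not (trans (memI≡lookupℕ {n} R (2 * b)) (to T-not-≡ (T-not⁺ (noBar b))))

  evens-tildeOut-count : ∣ R ∣ ≡ n ∸ 1 → 0 < n → countB (tildeOut n R) (upTo n) ≡ 1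
  evens-tildeOut-count ∣R∣≡ 0<n =
    trans (countB-cong (tildeOut n R) {xs = upTo n} λ {b} _ → cong not (memI≡lookupℕ {n} R (suc (2 * b))))
          complement
    where
    open ≡-Reasoning
    #in : countB inTilde (upTo n) ≡ n ∸ 1
    #in = begin
      countB inTilde (upTo n)                                             ≡⟨ cong (_+ countB inTilde (upTo n))
                                                                               (sym (countB-≡0 (lookupℕ R ∘ (2 *_)) {upTo n} λ {b} _ → noBar b)) ⟩
      countB (lookupℕ R ∘ (2 *_)) (upTo n) + countB inTilde (upTo n)      ≡⟨ sym (countB-upTo-double (lookupℕ R) n) ⟩
      countB (lookupℕ R) (upTo (2 * n))                                   ≡⟨ sym (∣∣≡countB-lookupℕ R) ⟩
      ∣ R ∣                                                               ≡⟨ ∣R∣≡ ⟩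
      n ∸ 1                                                               ∎
    #in+#out : countB inTilde (upTo n) + countB (not ∘ inTilde) (upTo n) ≡ n
    #in+#out = trans (countB-+-countB-not inTilde (upTo n)) (length-upTo n)
    complement : countB (not ∘ inTilde) (upTo n) ≡ 1
    complement = begin
      countB (not ∘ inTilde) (upTo n)                                     ≡⟨ sym (m+n∸m≡n (countB inTilde (upTo n)) _) ⟩
      countB inTilde (upTo n) + countB (not ∘ inTilde) (upTo n) ∸ countB inTilde (upTo n)
                                                                          ≡⟨ cong₂ _∸_ #in+#out #in ⟩
      n ∸ (n ∸ 1)                                                         ≡⟨ m∸[m∸n]≡n 0<n ⟩
      1                                                                   ∎

toℕ-prevF : ∀ {n} (j : Fin n) → toℕ (prevF j) ≡ cycPred n (toℕ j)
toℕ-prevF {suc k} Fin.zero = trans (toℕ-fromℕ< (m%n<n k (suc k))) (m<n⇒m%n≡m (n<1+n k))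
toℕ-prevF {suc k} (Fin.suc j) = begin
  toℕ (fromℕ< (m%n<n (suc (toℕ j) + k) (suc k))) ≡⟨ toℕ-fromℕ< (m%n<n (suc (toℕ j) + k) (suc k)) ⟩
  (suc (toℕ j) + k) % suc k                     ≡⟨ cong (_% suc k) (sym (+-suc (toℕ j) k)) ⟩
  (toℕ j + suc k) % suc k                       ≡⟨ [m+n]%n≡m%n (toℕ j) (suc k) ⟩
  toℕ j % suc k                                 ≡⟨ m<n⇒m%n≡m (<-trans (toℕ<n j) (n<1+n k)) ⟩
  toℕ j                                         ∎
  where open ≡-Reasoning

module _ {n : ℕ} (i j : Fin n) where

  private
    member : ℕ → Bool
    member p = (p ≡ᵇ 2 * toℕ i)
               ∨ (not (even? p) ∧ not (p / 2 ≡ᵇ toℕ j) ∧ not (p / 2 ≡ᵇ toℕ (prevF j)))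

    memI-member : ∀ {p} → p < 2 * n → memI {n} (barWithEvensExcept i j) p ≡ member p
    memI-member {p} p<2n = trans (memI≡lookupℕ {n} (barWithEvensExcept i j) p) (lookupℕ-tabulate member p<2n)

    double-≡ᵇ : ∀ a b → (2 * a ≡ᵇ 2 * b) ≡ (a ≡ᵇ b)
    double-≡ᵇ a b = T-injective (λ e → ≡⇒≡ᵇ a b (*-cancelˡ-≡ a b 2 (≡ᵇ⇒≡ _ _ e)))
                                (λ e → ≡⇒≡ᵇ (2 * a) _ (cong (2 *_) (≡ᵇ⇒≡ a b e)))

    tilde≢ᵇbar : ∀ a b → (suc (2 * a) ≡ᵇ 2 * b) ≡ false
    tilde≢ᵇbar a b = to T-not-≡ (T-not⁺ λ e →
      subst T (trans (sym (even?-bar b))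
                     (trans (cong even? (sym (≡ᵇ⇒≡ (suc (2 * a)) (2 * b) e))) (even?-tilde a))) tt)

    not-not∧not : ∀ x y → not (not x ∧ not y) ≡ x ∨ y
    not-not∧not false y = not-involutive y
    not-not∧not true  y = refl

  barWithEvensExcept-barOut : ∀ {b} → b < n → barOut n (barWithEvensExcept i j) b ≡ not (b ≡ᵇ toℕ i)
  barWithEvensExcept-barOut {b} b<n rewrite memI-member (bar<bar⁺ b<n) | even?-bar b
    = cong not (trans (∨-identityʳ _) (double-≡ᵇ b (toℕ i)))

  barWithEvensExcept-tildeOut : ∀ {b} → b < n →
    tildeOut n (barWithEvensExcept i j) b ≡ (b ≡ᵇ toℕ j) ∨ (b ≡ᵇ cycPred n (toℕ j))
  barWithEvensExcept-tildeOut {b} b<n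
    rewrite memI-member (tilde<bar⁺ b<n) | tilde≢ᵇbar b (toℕ i) | even?-tilde b | half-tilde b | toℕ-prevF j
    = not-not∧not (b ≡ᵇ toℕ j) _

module _ {n lo hi : ℕ} (lo<hi : lo < hi) (hi<n : hi < n) {s : List ℕ} (reps : Represents n (pairRel lo hi) s)
         {j : ℕ} (j<n : j < n) where
  open Arc lo hi

  private
    arc = allPartitions-represents (sameSide-isEquivOn {n})

  ordered-pair-tildes⁺ : j ≡ lo ⊎ j ≡ hi →
    ∃ λ t → t ∈ allPartitions n × T (isKreweras n s t) × OnePerBlock n (sameL t) (nextTo n j)
  ordered-pair-tildes⁺ endpoint =
    let t , t∈ , rept = arc in
    t , t∈ , isKreweras-pair lo<hi hi<n reps rept ,
    OnePerBlock-cong (λ a<n b<n → sym (sameL≡ rept a<n b<n)) (λ _ → refl)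
                     (endpoint⇒OnePerBlock lo<hi hi<n j<n endpoint)

  ordered-pair-tildes⁻ : ∀ {t} → T (isKreweras n s t) → OnePerBlock n (sameL t) (nextTo n j) →
                         j ≡ lo ⊎ j ≡ hi
  ordered-pair-tildes⁻ {t} kre = coarser-OnePerBlock⇒endpoint lo<hi hi<n j<n λ a<n b<n ab →
    let t₀ , t₀∈ , rep₀ = arc in
    isKreweras⁻ s t kre t₀∈ (nonCrossing⁺ (pair-arc-nonCrossing lo<hi hi<n reps rep₀)) a<n b<n
      (subst T (sym (sameL≡ rep₀ a<n b<n)) ab)

module _ {n u v : ℕ} (u<n : u < n) (v<n : v < n) (u≢v : u ≢ v) {s : List ℕ} (rep : Represents n (pairRel u v) s)
         {j : ℕ} (j<n : j < n) where

  private
    rep˘ : Represents n (pairRel v u) s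
    rep˘ = represents λ {a} {b} a<n b<n → trans (sameL≡ rep a<n b<n) (pairRel-comm u v a b)

  pair-tildes⁺ : j ≡ u ⊎ j ≡ v →
    ∃ λ t → t ∈ allPartitions n × T (isKreweras n s t) × OnePerBlock n (sameL t) (nextTo n j)
  pair-tildes⁺ endpoint with <-cmp u v
  ... | tri< u<v _ _ = ordered-pair-tildes⁺ u<v v<n rep j<n endpoint
  ... | tri≈ _ u≡v _ = ⊥-elim (u≢v u≡v)
  ... | tri> _ _ v<u = ordered-pair-tildes⁺ v<u u<n rep˘ j<n (swap endpoint)

  pair-tildes⁻ : ∀ {t} → T (isKreweras n s t) → OnePerBlock n (sameL t) (nextTo n j) → j ≡ u ⊎ j ≡ v
  pair-tildes⁻ {t} kre one with <-cmp u v
  ... | tri< u<v _ _ = ordered-pair-tildes⁻ u<v v<n rep j<n {t} kre one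
  ... | tri≈ _ u≡v _ = ⊥-elim (u≢v u≡v)
  ... | tri> _ _ v<u = swap (ordered-pair-tildes⁻ v<u u<n rep˘ j<n {t} kre one)

ncConcordant : ∀ n → Subset (2 * n) → List ℕ → Bool
ncConcordant n I s = nonCrossing n (sameL s) ∧ concordant {n} I s

module _ {n : ℕ} {R : Subset (2 * n)} (R⊆evens : R ⊆ evenIdx n) (∣R∣≡ : ∣ R ∣ ≡ n ∸ 1) where

  evens-concordant : ∀ s → ncConcordant n R s ≡ representsᵇ n _≡ᵇ_ s
  evens-concordant s = T-injective (representsᵇ⁺ ∘ discrete) (fromDiscrete ∘ representsᵇ⁻ {s = s})
    where
    allBars : ∀ {b} → b < n → T (barOut n R b)
    allBars {b} _ = subst T (sym (evens-barOut {n} R⊆evens b)) tt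
    discrete : T (ncConcordant n R s) → Represents n _≡ᵇ_ s
    discrete ok =
      let _ , _ , _ , bars , _ = concordant⁻ R s (proj₂ (to T-∧ ok)) in OnePerBlock⇒discrete allBars bars
    fromDiscrete : Represents n _≡ᵇ_ s → T (ncConcordant n R s)
    fromDiscrete rep =
      let t , t∈ , rept = allPartitions-represents total-isEquivOn
          tildes = onePerBlock λ a<n →
            trans (countB-cong _ λ {b} b∈ → cong (_∧ tildeOut n R b) (sameL≡ rept a<n (∈-upTo⁻ b∈)))
                  (evens-tildeOut-count {n} R⊆evens ∣R∣≡ (≤-<-trans z≤n a<n))
      in from T-∧ (nonCrossing⁺ (NonCrossing-Represents rep ≡ᵇ-nonCrossing) ,
                   concordant⁺ R s t∈ (isKreweras-discrete rep rept) (discrete⇒OnePerBlock allBars rep) tildes)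

module _ {n : ℕ} (i j : Fin n) where

  private
    I = barWithEvensExcept i j

  barWithEvensExcept-concordant⁻ : ∀ s → T (ncConcordant n I s) →
    ∃ λ x → x < n × x ≢ toℕ i × Represents n (pairRel (toℕ i) x) s × (toℕ j ≡ toℕ i ⊎ toℕ j ≡ x)
  barWithEvensExcept-concordant⁻ s ok =
    let t , _ , kre , bars , tildes = concordant⁻ I s (proj₂ (to T-∧ ok))
        x , x<n , x≢i , rep = OnePerBlock-except⇒pair (toℕ<n i)
                                (OnePerBlock-cong (λ _ _ → refl) (barWithEvensExcept-barOut i j) bars)
    in x , x<n , x≢i , rep , pair-tildes⁻ (toℕ<n i) x<n (x≢i ∘ sym) rep (toℕ<n j) {t} kre
                               (OnePerBlock-cong (λ _ _ → refl) (barWithEvensExcept-tildeOut i j) tildes)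

  barWithEvensExcept-concordant⁺ : ∀ s {x} → x < n → x ≢ toℕ i → Represents n (pairRel (toℕ i) x) s →
    toℕ j ≡ toℕ i ⊎ toℕ j ≡ x → T (ncConcordant n I s)
  barWithEvensExcept-concordant⁺ s x<n x≢i rep near =
    let t , t∈ , kre , tildes = pair-tildes⁺ (toℕ<n i) x<n (x≢i ∘ sym) rep (toℕ<n j) near
    in from T-∧ (nonCrossing⁺ (NonCrossing-Represents rep pairRel-nonCrossing) ,
         concordant⁺ I s t∈ kre
           (OnePerBlock-cong (λ _ _ → refl) (sym ∘ barWithEvensExcept-barOut i j)
              (pair⇒OnePerBlock-except (toℕ<n i) x<n x≢i rep))
           (OnePerBlock-cong (λ _ _ → refl) (sym ∘ barWithEvensExcept-tildeOut i j) tildes))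

  barWithEvensExcept-concordant : i ≢ j → ∀ s →
    ncConcordant n I s ≡ representsᵇ n (pairRel (toℕ i) (toℕ j)) s
  barWithEvensExcept-concordant i≢j s = T-injective
    (λ ok → let x , _ , _ , rep , near = barWithEvensExcept-concordant⁻ s ok in representsᵇ⁺ (partner-j rep near))
    (λ ok → barWithEvensExcept-concordant⁺ s (toℕ<n j) (i≢j ∘ toℕ-injective ∘ sym)
                                              (representsᵇ⁻ {s = s} ok) (inj₂ refl))
    where
    partner-j : ∀ {x} → Represents n (pairRel (toℕ i) x) s → toℕ j ≡ toℕ i ⊎ toℕ j ≡ x →
                Represents n (pairRel (toℕ i) (toℕ j)) s
    partner-j _   (inj₁ j≡i)  = ⊥-elim (i≢j (toℕ-injective (sym j≡i)))
    partner-j rep (inj₂ refl) = rep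

module _ {n : ℕ} (k : Fin n) where

  pairedWith : Fin n → List ℕ → Bool
  pairedWith x s = not (eqF x k) ∧ representsᵇ n (pairRel (toℕ k) (toℕ x)) s

  private
    pairedWith⁻ : ∀ {x s} → T (pairedWith x s) → toℕ x ≢ toℕ k × Represents n (pairRel (toℕ k) (toℕ x)) s
    pairedWith⁻ {x} {s} ok = let x≢k , rep = to T-∧ ok in
      T-not⁻ x≢k ∘ ≡⇒≡ᵇ (toℕ x) (toℕ k) , representsᵇ⁻ {s = s} rep

  concordant⇒pairedWith : ∀ s → T (ncConcordant n (barWithEvensExcept k k) s) →
                          ∃ λ x → x ∈ allFin n × T (pairedWith x s)
  concordant⇒pairedWith s ok =
    let x , x<n , x≢k , rep , _ = barWithEvensExcept-concordant⁻ k k s ok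
        x≡ = toℕ-fromℕ< x<n
    in fromℕ< x<n , ∈-allFin _ ,
       from T-∧ (≢⇒T-not-≡ᵇ (x≢k ∘ trans (sym x≡)) ,
                 representsᵇ⁺ (subst (λ y → Represents n (pairRel (toℕ k) y) s) (sym x≡) rep))

  pairedWith-unique : ∀ {s x y} → T (pairedWith x s) → T (pairedWith y s) → x ≡ y
  pairedWith-unique {s} {x} {y} ok ok' =
    let x≢k , repx = pairedWith⁻ {x} {s} ok; y≢k , repy = pairedWith⁻ {y} {s} ok' in
    toℕ-injective (pair-partner-unique (toℕ<n k) (toℕ<n x) x≢k y≢k repx repy)

  pairedWith⇒concordant : ∀ s {x} → T (pairedWith x s) → T (ncConcordant n (barWithEvensExcept k k) s)
  pairedWith⇒concordant s {x} ok = let x≢k , rep = pairedWith⁻ {x} {s} ok in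
    barWithEvensExcept-concordant⁺ k k s (toℕ<n x) x≢k rep (inj₁ refl)

module _ {n : ℕ} (N : Network n) where

  Lσ-cong : ∀ {R R' : Fin n → Fin n → Bool} → (∀ a b → R a b ≡ R' a b) → Lσ N R ≡ Lσ N R'
  Lσ-cong R≡R' = cong sumℚ (map-cong (λ S → cong (λ b → if isGrove N S ∧ b then weight N S else 0ℚ)
    (all-cong {xs = allFin n} λ a → all-cong {xs = allFin n} λ b →
      cong (beq (conn N S (Network.bd N a) (Network.bd N b))) (R≡R' a b)))
    (allSubsets (Network.E N)))
    where
    all-cong : ∀ {A : Set} {p q : A → Bool} {xs} → (∀ x → p x ≡ q x) → all p xs ≡ all q xs
    all-cong {xs = xs} p≡q = cong and (map-cong p≡q xs)

  sumIf-represents : ∀ {P E} → IsEquivOn n E → (∀ s → P s ≡ representsᵇ n E s) →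
    sumIf P (Lσ N ∘ relOf) (allPartitions n) ≡ Lσ N (λ a b → E (toℕ a) (toℕ b))
  sumIf-represents {P} {E} equiv P≡ = sumIf-≡1 P (Lσ N ∘ relOf) (allPartitions n)
    (trans (countB-cong P {xs = allPartitions n} (λ {s} _ → P≡ s)) (allPartitions-represents-once equiv))
    λ {s} _ ok → Lσ-cong λ a b → sameL≡ (representsᵇ⁻ {s = s} (subst T (P≡ s) ok)) (toℕ<n a) (toℕ<n b)

  Δ-diagonal : ∀ k → Δ N (barWithEvensExcept k k) ≡ Lkk N k
  Δ-diagonal k = trans
    (sumIf-split (ncConcordant n (barWithEvensExcept k k)) (pairedWith k) (Lσ N ∘ relOf) (allPartitions n)
                 (allFin⁺ n) (concordant⇒pairedWith k) (λ {s} → pairedWith-unique k {s})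
                 (λ {s} → pairedWith⇒concordant k s))
    (cong sumℚ (map-cong each (allFin n)))
    where
    each : ∀ x → sumIf (pairedWith k x) (Lσ N ∘ relOf) (allPartitions n) ≡ (if eqF x k then 0ℚ else Lij N x k)
    each x with eqF x k
    ... | true  = sumℚ-zeros (allPartitions n)
    ... | false = trans (sumIf-represents {P = representsᵇ n (pairRel (toℕ k) (toℕ x))}
                                          pairRel-isEquivOn λ _ → refl)
                        (Lσ-cong λ a b → pairRel-comm (toℕ k) (toℕ x) (toℕ a) (toℕ b))

mainTheorem2 : (n : ℕ) (N : Network n) →
    CircularPlanarEmbedding N →
    (∀ e → Positive (Network.cond N e)) →
    Injective _≡_ _≡_ (Network.bd N) →
    (∀ (R : Subset (2 * n)) → R ⊆ evenIdx n → ∣ R ∣ ≡ n ∸ 1 → L N ≡ Δ N R)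
    × (∀ (i j : Fin n) → i ≢ j → Lij N i j ≡ Δ N (barWithEvensExcept i j))
    × (∀ (k : Fin n) → Lkk N k ≡ Δ N (barWithEvensExcept k k))
mainTheorem2 n N _ _ _ =
  (λ R R⊆evens ∣R∣≡ → sym (sumIf-represents N ≡ᵇ-isEquivOn (evens-concordant {n} R⊆evens ∣R∣≡))) ,
  (λ i j i≢j → sym (sumIf-represents N pairRel-isEquivOn (barWithEvensExcept-concordant i j i≢j))) ,
  (λ k → sym (Δ-diagonal N k))
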